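{- Let $G=(V,E)$ be a finite graph with $n=|V|$ and let $0<p\le1/2$. Draw $S$ from the worm measure $\pi_{worm}$ with parameter $p$, and then add each edge $e\notin S$ independently with probability $\frac{p}{1-p}$, obtaining a random edge set $R$; let $\widehat{\pi}$ be the distribution of $R$. Then for every $R\subseteq E$, $$\frac{\widehat{\pi}(R)}{\pi_{RC;2p,2}(R)}\le\frac32,$$ where $\pi_{RC;2p,2}(R)\propto (2p)^{|R|}(1-2p)^{|E\setminus R|}2^{\kappa(R)}$ is the random cluster measure with parameters $(2p,2)$ and $\kappa(R)$ is the number of connected components of $(V,R)$.
   Context: For $k\ge0$, $\Omega_k$ is the set of subsets $S\subseteq E$ with exactly $k$ odd-degree vertices in $(V,S)$, and $\Omega_{worm}=\Omega_0\cup\Omega_2$. With $w_p(S)=p^{|S|}(1-p)^{|E\setminus S|}$, set $w_{worm}(S)=w_p(S)$ for $S\in\Omega_0$, $w_{worm}(S)=n^{ -2}w_p(S)$ for $S\in\Omega_2$, $0$ otherwise, and $\pi_{worm}(S)=w_{worm}(S)/\sum_{T}w_{worm}(T)$.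
   Formalization: The parameter p ranges over the rationals with $0<p\le1/2$. -}

module Defs where

open import Data.Bool using (Bool; true; false; _∧_; _∨_; not; if_then_else_)
open import Data.Nat as ℕ using (ℕ; zero; suc; _%_; _≡ᵇ_; _<ᵇ_)
open import Data.Fin using (Fin; toℕ) renaming (zero to fz; suc to fs)
open import Data.Fin.Properties using () renaming (_≟_ to _≟ᶠ_)
open import Data.Fin.Subset using (Subset)
open import Data.Vec using (Vec; []; _∷_; lookup)
open import Data.List using (List; []; _∷_; _++_; map; foldr)
open import Data.Product using (_×_; _,_; proj₁; proj₂)
open import Data.Rational using (ℚ; 0ℚ; 1ℚ; _+_; _*_; _-_; _÷_; ≢-nonZero)
open import Data.Rational.Properties using (_≟_)
open import Relation.Nullary using (yes; no; does)

-- Finite graphs (multigraphs, loops allowed): vertices Fin n, edges Fin m,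
-- edge e has endpoints  ends e.  Edge subsets are  Subset m  (Vec Bool m).

Ends : ℕ → ℕ → Set
Ends n m = Fin m → Fin n × Fin n

sumFin : ∀ {k} → (Fin k → ℚ) → ℚ
sumFin {zero}  f = 0ℚ
sumFin {suc k} f = f fz + sumFin (λ i → f (fs i))

countFin : ∀ {k} → (Fin k → Bool) → ℕ
countFin {zero}  f = 0
countFin {suc k} f = (if f fz then 1 else 0) ℕ.+ countFin (λ i → f (fs i))

anyFin : ∀ {k} → (Fin k → Bool) → Bool
anyFin {zero}  f = false
anyFin {suc k} f = f fz ∨ anyFin (λ i → f (fs i))

allFin : ∀ {k} → (Fin k → Bool) → Bool
allFin {zero}  f = true
allFin {suc k} f = f fz ∧ allFin (λ i → f (fs i))

sumList : List ℚ → ℚ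
sumList = foldr _+_ 0ℚ

allSubsets : ∀ m → List (Subset m)
allSubsets zero    = [] ∷ []
allSubsets (suc m) = map (false ∷_) (allSubsets m) ++ map (true ∷_) (allSubsets m)

sumSubsets : ∀ {m} → (Subset m → ℚ) → ℚ
sumSubsets {m} f = sumList (map f (allSubsets m))

pow : ℚ → ℕ → ℚ
pow x zero    = 1ℚ
pow x (suc k) = x * pow x k

fromℕ : ℕ → ℚ
fromℕ zero    = 0ℚ
fromℕ (suc k) = 1ℚ + fromℕ k

-- total division (convention x / 0 = 0; only ever used with
-- positive denominators under the hypotheses of the lemma)
_/'_ : ℚ → ℚ → ℚ
x /' y with y ≟ 0ℚ
... | yes _  = 0ℚ
... | no y≢0 = _÷_ x y {{≢-nonZero y≢0}}

module _ {n m : ℕ} (ends : Ends n m) where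

  size : Subset m → ℕ
  size S = countFin (λ e → lookup S e)

  -- degree of v in (V,S); a loop contributes 2
  degree : Subset m → Fin n → ℕ
  degree S v = sumℕ (λ e → if lookup S e
                             then (hit (proj₁ (ends e)) ℕ.+ hit (proj₂ (ends e)))
                             else 0)
    where
    hit : Fin n → ℕ
    hit u = if does (u ≟ᶠ v) then 1 else 0
    sumℕ : ∀ {k} → (Fin k → ℕ) → ℕ
    sumℕ {zero}  f = 0
    sumℕ {suc k} f = f fz ℕ.+ sumℕ (λ i → f (fs i))

  oddCount : Subset m → ℕ
  oddCount S = countFin (λ v → degree S v % 2 ≡ᵇ 1)

  adj : Subset m → Fin n → Fin n → Bool
  adj R u v = anyFin (λ e → lookup R e ∧
                 ((does (proj₁ (ends e) ≟ᶠ u) ∧ does (proj₂ (ends e) ≟ᶠ v)) ∨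
                  (does (proj₁ (ends e) ≟ᶠ v) ∧ does (proj₂ (ends e) ≟ᶠ u))))

  reachK : Subset m → ℕ → Fin n → Fin n → Bool
  reachK R zero    u v = does (u ≟ᶠ v)
  reachK R (suc k) u v = reachK R k u v ∨ anyFin (λ w → reachK R k u w ∧ adj R w v)

  -- u, v in the same connected component of (V,R) (walks of length ≤ n suffice)
  connected : Subset m → Fin n → Fin n → Bool
  connected R = reachK R n

  -- κ(R): number of connected components of (V,R), counted as the number
  -- of vertices that are the smallest vertex of their component
  κ : Subset m → ℕ
  κ R = countFin (λ v → allFin (λ u → not ((toℕ u <ᵇ toℕ v) ∧ connected R u v)))

  module _ (p : ℚ) where

    wp : Subset m → ℚ
    wp S = pow p (size S) * pow (1ℚ - p) (m ℕ.∸ size S)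

    -- worm weight: Ω₀ ↦ w_p, Ω₂ ↦ n^{-2} w_p, otherwise 0
    wWorm : Subset m → ℚ
    wWorm S with oddCount S
    ... | 0 = wp S
    ... | 2 = wp S /' fromℕ (n ℕ.* n)
    ... | _ = 0ℚ

    πWorm : Subset m → ℚ
    πWorm S = wWorm S /' sumSubsets wWorm

    q : ℚ
    q = p /' (1ℚ - p)

    trans : Subset m → Subset m → ℚ
    trans S R = prod (λ e → edgeFactor (lookup S e) (lookup R e))
      where
      edgeFactor : Bool → Bool → ℚ
      edgeFactor true  true  = 1ℚ
      edgeFactor true  false = 0ℚ
      edgeFactor false true  = q
      edgeFactor false false = 1ℚ - q
      prod : ∀ {k} → (Fin k → ℚ) → ℚ
      prod {zero}  f = 1ℚ
      prod {suc k} f = f fz * prod (λ i → f (fs i))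

    πHat : Subset m → ℚ
    πHat R = sumSubsets (λ S → πWorm S * trans S R)

  wRC : ℚ → ℚ → Subset m → ℚ
  wRC r Q R = pow r (size R) * pow (1ℚ - r) (m ℕ.∸ size R) * pow Q (κ R)

  πRC : ℚ → ℚ → Subset m → ℚ
  πRC r Q R = wRC r Q R /' sumSubsets (wRC r Q)

-- Edge by edge, (1 - p)q = p and (1 - p)(1 - q) = 1 - 2p turn w_p(S) P(R | S) into
-- [S ⊆ R] p^|R| (1 - 2p)^|E \ R|.  So, before normalisation, π̂(R) is
-- p^|R| (1 - 2p)^|E \ R| (E₀(R) + n⁻² E₂(R)), where E₀(R) and E₂(R) count the subgraphs of
-- (V, R) with no and with exactly two odd vertices.  The even subgraphs form the cycle space,
-- so 2ⁿ E₀(R) = 2^(|R| + κ(R)): adding an edge inside a component doubles E₀, while an edge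
-- joining two components leaves E₀ unchanged and merges them.  Hence 2ⁿ p^|R| (1 - 2p)^|E \ R| E₀(R)
-- is exactly the random cluster weight with parameters (2p, 2).  The subgraphs with odd vertices
-- {u, v} form a coset of the cycle space or nothing, so 2 E₂(R) ≤ n² E₀(R).  Thus 2ⁿ π̂ lies
-- between the random cluster weight and 3/2 of it before normalisation, and the normalised
-- ratio is at most 3/2.

module Submission where

open import Defs renaming (trans to transition)
open import Data.Nat using (ℕ)
open import Data.Fin.Subset using (Subset; ⁅_⁆) renaming (⊥ to ∅)
open import Data.Rational using (ℚ; 0ℚ; ½; _<_; _≤_; _*_; _+_; 1ℚ)

open import Data.Bool using (Bool; true; false; not; _∧_; _∨_; _xor_; if_then_else_)
open import Data.Bool.Properties as Bool using (¬-not)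
open import Data.Empty using (⊥; ⊥-elim)
open import Data.Fin using (Fin; toℕ) renaming (zero to fz; suc to fs)
open import Data.Fin.Properties using (toℕ-injective; all?; ¬∀⟶∃¬) renaming (_≟_ to _≟ᶠ_)
open import Data.List using (List; []; _∷_; _++_; map)
import Data.List.Properties as List
open import Data.Nat as ℕ using (zero; suc; _<ᵇ_; _≡ᵇ_)
import Data.Nat.Properties as ℕ
import Data.Nat.DivMod as DivMod
open import Data.Product using (∃; _×_; _,_; proj₁; proj₂)
open import Function using (_∘_)
open import Function.Bundles using (Equivalence)
open import Data.Rational using (_-_; 1/_; ≢-nonZero; positive; nonNegative)
import Data.Rational.Properties as ℚ
open import Data.Rational.Solver using (module +-*-Solver)
open import Data.Sum using (_⊎_; inj₁; inj₂)
open import Data.Vec using ([]; _∷_; lookup; zipWith)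
open import Relation.Binary.Definitions using (tri<; tri≈; tri>)
open import Relation.Binary.Structures using (IsEquivalence)
open import Relation.Binary.PropositionalEquality
open import Relation.Nullary using (¬_; yes; no; does)

open import Algebra.Bundles using (CommutativeRing)
open import Algebra.Properties.CommutativeSemigroup ℕ.+-commutativeSemigroup
  using () renaming (interchange to +-interchange)
open import Algebra.Properties.CommutativeSemigroup
  (CommutativeRing.+-commutativeSemigroup Bool.xor-∧-commutativeRing)
  using () renaming (interchange to xor-interchange)

∨-true⁻ : ∀ a {b} → a ∨ b ≡ true → a ≡ true ⊎ b ≡ true
∨-true⁻ true  _ = inj₁ refl
∨-true⁻ false e = inj₂ e

∧-true⁻ : ∀ a {b} → a ∧ b ≡ true → a ≡ true × b ≡ true
∧-true⁻ true  e = refl , e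

∨-trueˡ : ∀ {a} b → a ≡ true → a ∨ b ≡ true
∨-trueˡ b refl = refl

∨-trueʳ : ∀ a {b} → b ≡ true → a ∨ b ≡ true
∨-trueʳ true  _ = refl
∨-trueʳ false e = e

∧-true : ∀ {a b} → a ≡ true → b ≡ true → a ∧ b ≡ true
∧-true refl refl = refl

true≢false : ∀ {a} → a ≡ true → a ≡ false → ⊥
true≢false refl ()

bool-ext : ∀ {a b} → (a ≡ true → b ≡ true) → (b ≡ true → a ≡ true) → a ≡ b
bool-ext {true}  {true}  _ _ = refl
bool-ext {false} {false} _ _ = refl
bool-ext {true}  {false} f _ = sym (f refl)
bool-ext {false} {true}  _ g = g refl

xor-cancel : ∀ t p → t xor (p xor t) ≡ p
xor-cancel false p     = Bool.xor-identityʳ p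
xor-cancel true  false = refl
xor-cancel true  true  = refl

xor-chain : ∀ a b c → (a xor b) xor (b xor c) ≡ a xor c
xor-chain a b c = begin
  (a xor b) xor (b xor c) ≡⟨ Bool.xor-assoc a b (b xor c) ⟩
  a xor (b xor (b xor c)) ≡⟨ cong (a xor_) (Bool.xor-assoc b b c) ⟨
  a xor ((b xor b) xor c) ≡⟨ cong (λ x → a xor (x xor c)) (Bool.xor-same b) ⟩
  a xor c                 ∎
  where open ≡-Reasoning

ind : Bool → ℕ
ind b = if b then 1 else 0

δ : ∀ {n} → Fin n → Fin n → Bool
δ x v = does (x ≟ᶠ v)

δ-refl : ∀ {n} (x : Fin n) → δ x x ≡ true
δ-refl fz     = refl
δ-refl (fs x) = δ-refl x

δ-true : ∀ {n} {x v : Fin n} → δ x v ≡ true → x ≡ v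
δ-true {x = x} {v} e with x ≟ᶠ v
... | yes x≡v = x≡v

allFin-true⁻ : ∀ {k} (f : Fin k → Bool) → allFin f ≡ true → ∀ i → f i ≡ true
allFin-true⁻ f e fz     = proj₁ (∧-true⁻ (f fz) e)
allFin-true⁻ f e (fs i) = allFin-true⁻ (f ∘ fs) (proj₂ (∧-true⁻ (f fz) e)) i

allFin-true : ∀ {k} (f : Fin k → Bool) → (∀ i → f i ≡ true) → allFin f ≡ true
allFin-true {zero}  f h = refl
allFin-true {suc k} f h = ∧-true (h fz) (allFin-true (f ∘ fs) (h ∘ fs))

anyFin-true⁻ : ∀ {k} (f : Fin k → Bool) → anyFin f ≡ true → ∃ λ i → f i ≡ true
anyFin-true⁻ {suc k} f e with ∨-true⁻ (f fz) e
... | inj₁ f0 = fz , f0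
... | inj₂ rest = let (i , fi) = anyFin-true⁻ (f ∘ fs) rest in fs i , fi

anyFin-true : ∀ {k} (f : Fin k → Bool) i → f i ≡ true → anyFin f ≡ true
anyFin-true f fz     e = ∨-trueˡ _ e
anyFin-true f (fs i) e = ∨-trueʳ (f fz) (anyFin-true (f ∘ fs) i e)

anyFin-cong : ∀ {k} {f g : Fin k → Bool} → (∀ i → f i ≡ g i) → anyFin f ≡ anyFin g
anyFin-cong {zero}  h = refl
anyFin-cong {suc k} h = cong₂ _∨_ (h fz) (anyFin-cong (h ∘ fs))

allFin-cong : ∀ {k} {f g : Fin k → Bool} → (∀ i → f i ≡ g i) → allFin f ≡ allFin g
allFin-cong {zero}  h = refl
allFin-cong {suc k} h = cong₂ _∧_ (h fz) (allFin-cong (h ∘ fs))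

countFin-cong : ∀ {k} {f g : Fin k → Bool} → (∀ i → f i ≡ g i) → countFin f ≡ countFin g
countFin-cong {zero}  h = refl
countFin-cong {suc k} h =
  cong₂ (λ a b → ind a ℕ.+ b) (h fz) (countFin-cong (h ∘ fs))

countFin-≤ : ∀ {k} (f : Fin k → Bool) → countFin f ℕ.≤ k
countFin-≤ {zero}  f = ℕ.z≤n
countFin-≤ {suc k} f with f fz
... | true  = ℕ.s≤s (countFin-≤ (f ∘ fs))
... | false = ℕ.m≤n⇒m≤1+n (countFin-≤ (f ∘ fs))

countFin-mono : ∀ {k} {f g : Fin k → Bool} → (∀ i → f i ≡ true → g i ≡ true) →
  countFin f ℕ.≤ countFin g
countFin-mono {zero} f⊆g = ℕ.z≤n
countFin-mono {suc k} {f} {g} f⊆g with f fz in f0 | g fz in g0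
... | true  | true  = ℕ.s≤s (countFin-mono (λ j → f⊆g (fs j)))
... | false | true  = ℕ.m≤n⇒m≤1+n (countFin-mono (λ j → f⊆g (fs j)))
... | false | false = countFin-mono (λ j → f⊆g (fs j))
... | true  | false = ⊥-elim (true≢false (f⊆g fz f0) g0)

countFin-< : ∀ {k} {f g : Fin k → Bool} → (∀ i → f i ≡ true → g i ≡ true) →
  ∀ i → f i ≡ false → g i ≡ true → countFin f ℕ.< countFin g
countFin-< {suc k} {f} {g} f⊆g fz fi gi rewrite fi | gi = ℕ.s≤s (countFin-mono (λ j → f⊆g (fs j)))
countFin-< {suc k} {f} {g} f⊆g (fs i) fi gi with f fz in f0 | g fz in g0
... | true  | true  = ℕ.s≤s (countFin-< (λ j → f⊆g (fs j)) i fi gi)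
... | false | true  = ℕ.m≤n⇒m≤1+n (countFin-< (λ j → f⊆g (fs j)) i fi gi)
... | false | false = countFin-< (λ j → f⊆g (fs j)) i fi gi
... | true  | false = ⊥-elim (true≢false (f⊆g fz f0) g0)

countFin-pos : ∀ {k} (f : Fin k → Bool) i → f i ≡ true → 0 ℕ.< countFin f
countFin-pos f fz     fi rewrite fi = ℕ.s≤s ℕ.z≤n
countFin-pos f (fs i) fi with f fz
... | true  = ℕ.s≤s ℕ.z≤n
... | false = countFin-pos (f ∘ fs) i fi

least-true : ∀ {k} (f : Fin k → Bool) x → f x ≡ true →
  ∃ λ r → f r ≡ true × (∀ u → toℕ u ℕ.< toℕ r → f u ≡ false)
least-true {suc k} f x fx with f fz in f0
least-true {suc k} f x      fx | true  = fz , f0 , λ u ()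
least-true {suc k} f fz     fx | false = ⊥-elim (true≢false fx f0)
least-true {suc k} f (fs x) fx | false =
  let (r , fr , below) = least-true (f ∘ fs) x fx
  in fs r , fr , λ { fz _ → f0 ; (fs u) (ℕ.s≤s u<r) → below u u<r }

countFin-remove : ∀ {k} (f : Fin k → Bool) u → f u ≡ true →
  countFin f ≡ suc (countFin (λ w → f w xor δ u w))
countFin-remove f fz fu rewrite fu =
  cong suc (countFin-cong (λ j → sym (Bool.xor-identityʳ (f (fs j)))))
countFin-remove f (fs u) fu rewrite Bool.xor-identityʳ (f fz) =
  trans (cong (ind (f fz) ℕ.+_) (countFin-remove (f ∘ fs) u fu))
        (ℕ.+-suc (ind (f fz)) _)

countFin-all : ∀ {k} (f : Fin k → Bool) → (∀ i → f i ≡ true) → countFin f ≡ k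
countFin-all {zero}  f h = refl
countFin-all {suc k} f h rewrite h fz = cong suc (countFin-all (f ∘ fs) (h ∘ fs))

countFin-none : ∀ {k} (f : Fin k → Bool) → countFin f ≡ 0 → ∀ i → f i ≡ false
countFin-none {suc k} f c≡0 i with f fz in f0
countFin-none {suc k} f () i | true
countFin-none {suc k} f c≡0 fz     | false = f0
countFin-none {suc k} f c≡0 (fs i) | false = countFin-none (f ∘ fs) c≡0 i

countFin-one : ∀ {k} (f : Fin k → Bool) → countFin f ≡ 1 → ∃ λ v → ∀ w → f w ≡ δ v w
countFin-one {suc k} f c≡1 with f fz in f0
... | true  = fz , λ { fz → f0 ; (fs w) → countFin-none (f ∘ fs) (ℕ.suc-injective c≡1) w }
... | false = let (v , h) = countFin-one (f ∘ fs) c≡1 in fs v , λ { fz → f0 ; (fs w) → h w }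

countFin≡ᵇ0 : ∀ {k} (f : Fin k → Bool) → (countFin f ≡ᵇ 0) ≡ allFin (λ v → not (f v))
countFin≡ᵇ0 {zero}  f = refl
countFin≡ᵇ0 {suc k} f with f fz
... | true  = refl
... | false = countFin≡ᵇ0 (f ∘ fs)

sumFinℕ : ∀ {k} → (Fin k → ℕ) → ℕ
sumFinℕ {zero}  f = 0
sumFinℕ {suc k} f = f fz ℕ.+ sumFinℕ (f ∘ fs)

sumFinℕ-cong : ∀ {k} {f g : Fin k → ℕ} → (∀ i → f i ≡ g i) → sumFinℕ f ≡ sumFinℕ g
sumFinℕ-cong {zero}  h = refl
sumFinℕ-cong {suc k} h = cong₂ ℕ._+_ (h fz) (sumFinℕ-cong (h ∘ fs))

sumFinℕ-mono : ∀ {k} {f g : Fin k → ℕ} → (∀ i → f i ℕ.≤ g i) → sumFinℕ f ℕ.≤ sumFinℕ g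
sumFinℕ-mono {zero}  h = ℕ.z≤n
sumFinℕ-mono {suc k} h = ℕ.+-mono-≤ (h fz) (sumFinℕ-mono (h ∘ fs))

sumFinℕ-const : ∀ k c → sumFinℕ {k} (λ _ → c) ≡ k ℕ.* c
sumFinℕ-const zero    c = refl
sumFinℕ-const (suc k) c = cong (c ℕ.+_) (sumFinℕ-const k c)

sumFinℕ-single : ∀ {k} (f : Fin k → ℕ) i → f i ℕ.≤ sumFinℕ f
sumFinℕ-single f fz     = ℕ.m≤m+n (f fz) _
sumFinℕ-single f (fs i) = ℕ.≤-trans (sumFinℕ-single (f ∘ fs) i) (ℕ.m≤n+m _ (f fz))

countFin≡sumFinℕ : ∀ {k} (f : Fin k → Bool) → countFin f ≡ sumFinℕ (ind ∘ f)
countFin≡sumFinℕ {zero}  f = refl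
countFin≡sumFinℕ {suc k} f = cong (ind (f fz) ℕ.+_) (countFin≡sumFinℕ (f ∘ fs))

odd : ℕ → Bool
odd zero    = false
odd (suc k) = not (odd k)

odd-+ : ∀ a b → odd (a ℕ.+ b) ≡ odd a xor odd b
odd-+ zero    b = refl
odd-+ (suc a) b rewrite odd-+ a b = Bool.not-distribˡ-xor (odd a) (odd b)

%2≡ᵇ1≡odd : ∀ k → (k ℕ.% 2 ≡ᵇ 1) ≡ odd k
%2≡ᵇ1≡odd zero          = refl
%2≡ᵇ1≡odd (suc zero)    = refl
%2≡ᵇ1≡odd (suc (suc k)) = begin
  (2 ℕ.+ k) ℕ.% 2 ≡ᵇ 1 ≡⟨ cong (λ x → x ℕ.% 2 ≡ᵇ 1) (ℕ.+-comm 2 k) ⟩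
  (k ℕ.+ 2) ℕ.% 2 ≡ᵇ 1 ≡⟨ cong (_≡ᵇ 1) (DivMod.[m+n]%n≡m%n k 2) ⟩
  k ℕ.% 2 ≡ᵇ 1         ≡⟨ %2≡ᵇ1≡odd k ⟩
  odd k                ≡⟨ Bool.not-involutive (odd k) ⟨
  not (not (odd k))    ∎
  where open ≡-Reasoning

∂ₑ : ∀ {n m} → Ends n m → Fin m → Fin n → Bool
∂ₑ ends e v = δ (proj₁ (ends e)) v xor δ (proj₂ (ends e)) v

∂ : ∀ {n m} → Ends n m → Subset m → Fin n → Bool
∂ ends []      v = false
∂ ends (s ∷ S) v = (s ∧ ∂ₑ ends fz v) xor ∂ (ends ∘ fs) S v

odd-degree : ∀ {n m} (ends : Ends n m) S v → (degree ends S v ℕ.% 2 ≡ᵇ 1) ≡ ∂ ends S v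
odd-degree ends S v = trans (%2≡ᵇ1≡odd (degree ends S v)) (go ends S)
  where
  hit : Fin _ → ℕ
  hit x = if does (x ≟ᶠ v) then 1 else 0
  odd-hit : ∀ x → odd (hit x) ≡ δ x v
  odd-hit x with x ≟ᶠ v
  ... | yes _ = refl
  ... | no  _ = refl
  go : ∀ {m} (ends : Ends _ m) S → odd (degree ends S v) ≡ ∂ ends S v
  go ends []          = refl
  go ends (false ∷ S) = go (ends ∘ fs) S
  go ends (true  ∷ S) = begin
    odd (hit a ℕ.+ hit b ℕ.+ degree (ends ∘ fs) S v)
      ≡⟨ odd-+ (hit a ℕ.+ hit b) _ ⟩
    odd (hit a ℕ.+ hit b) xor odd (degree (ends ∘ fs) S v)
      ≡⟨ cong₂ _xor_ (odd-+ (hit a) (hit b)) (go (ends ∘ fs) S) ⟩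
    (odd (hit a) xor odd (hit b)) xor ∂ (ends ∘ fs) S v
      ≡⟨ cong₂ (λ x y → (x xor y) xor ∂ (ends ∘ fs) S v) (odd-hit a) (odd-hit b) ⟩
    ∂ₑ ends fz v xor ∂ (ends ∘ fs) S v ∎
    where
    open ≡-Reasoning
    a = proj₁ (ends fz)
    b = proj₂ (ends fz)

oddCount≡∣∂∣ : ∀ {n m} (ends : Ends n m) S → oddCount ends S ≡ countFin (∂ ends S)
oddCount≡∣∂∣ ends S = countFin-cong (odd-degree ends S)

_⊕_ : ∀ {m} → Subset m → Subset m → Subset m
_⊕_ = zipWith _xor_

∂-⊕ : ∀ {n m} (ends : Ends n m) S T v → ∂ ends (S ⊕ T) v ≡ ∂ ends S v xor ∂ ends T v
∂-⊕ ends []      []      v = refl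
∂-⊕ ends (s ∷ S) (t ∷ T) v = begin
  ((s xor t) ∧ X) xor ∂ (ends ∘ fs) (S ⊕ T) v
    ≡⟨ cong₂ _xor_ (Bool.∧-distribʳ-xor X s t) (∂-⊕ (ends ∘ fs) S T v) ⟩
  ((s ∧ X) xor (t ∧ X)) xor (∂ (ends ∘ fs) S v xor ∂ (ends ∘ fs) T v)
    ≡⟨ xor-interchange (s ∧ X) (t ∧ X) _ _ ⟩
  ((s ∧ X) xor ∂ (ends ∘ fs) S v) xor ((t ∧ X) xor ∂ (ends ∘ fs) T v) ∎
  where
  open ≡-Reasoning
  X = ∂ₑ ends fz v

∂-∅ : ∀ {n m} (ends : Ends n m) v → ∂ ends ∅ v ≡ false
∂-∅ {m = zero}  ends v = refl
∂-∅ {m = suc m} ends v = ∂-∅ (ends ∘ fs) v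

∂-⁅⁆ : ∀ {n m} (ends : Ends n m) e v → ∂ ends ⁅ e ⁆ v ≡ ∂ₑ ends e v
∂-⁅⁆ ends fz     v = trans (cong (∂ₑ ends fz v xor_) (∂-∅ (ends ∘ fs) v)) (Bool.xor-identityʳ _)
∂-⁅⁆ ends (fs e) v = ∂-⁅⁆ (ends ∘ fs) e v

-- Fibres of the boundary map S ↦ ∂S

_⊆ᵇ_ : ∀ {m} → Subset m → Subset m → Bool
[]      ⊆ᵇ []      = true
(s ∷ S) ⊆ᵇ (r ∷ R) = (not s ∨ r) ∧ (S ⊆ᵇ R)

∅⊆ᵇ : ∀ {m} (R : Subset m) → ∅ ⊆ᵇ R ≡ true
∅⊆ᵇ []      = refl
∅⊆ᵇ (r ∷ R) = ∅⊆ᵇ R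

⁅⁆⊆ᵇ : ∀ {m} (R : Subset m) e → lookup R e ≡ true → ⁅ e ⁆ ⊆ᵇ R ≡ true
⁅⁆⊆ᵇ (r ∷ R) fz     r≡true rewrite r≡true = ∅⊆ᵇ R
⁅⁆⊆ᵇ (r ∷ R) (fs e) Re     = ⁅⁆⊆ᵇ R e Re

⊕-⊆ᵇ : ∀ {m} (S T R : Subset m) → T ⊆ᵇ R ≡ true → (S ⊕ T) ⊆ᵇ R ≡ S ⊆ᵇ R
⊕-⊆ᵇ []      []      []      _   = refl
⊕-⊆ᵇ (s ∷ S) (t ∷ T) (r ∷ R) T⊆R =
  cong₂ _∧_ (head t r (proj₁ (∧-true⁻ (not t ∨ r) T⊆R))) (⊕-⊆ᵇ S T R (proj₂ (∧-true⁻ (not t ∨ r) T⊆R)))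
  where
  head : ∀ t r → not t ∨ r ≡ true → not (s xor t) ∨ r ≡ not s ∨ r
  head t     true  _ = trans (Bool.∨-zeroʳ _) (sym (Bool.∨-zeroʳ _))
  head false false _ = cong (λ x → not x ∨ false) (Bool.xor-identityʳ s)

sumSubℕ : ∀ {m} → (Subset m → ℕ) → ℕ
sumSubℕ {zero}  f = f []
sumSubℕ {suc m} f = sumSubℕ (f ∘ (false ∷_)) ℕ.+ sumSubℕ (f ∘ (true ∷_))

sumSubℕ-cong : ∀ {m} {f g : Subset m → ℕ} → (∀ S → f S ≡ g S) → sumSubℕ f ≡ sumSubℕ g
sumSubℕ-cong {zero}  h = h []
sumSubℕ-cong {suc m} h = cong₂ ℕ._+_ (sumSubℕ-cong (h ∘ (false ∷_))) (sumSubℕ-cong (h ∘ (true ∷_)))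

sumSubℕ-mono : ∀ {m} {f g : Subset m → ℕ} → (∀ S → f S ℕ.≤ g S) → sumSubℕ f ℕ.≤ sumSubℕ g
sumSubℕ-mono {zero}  h = h []
sumSubℕ-mono {suc m} h = ℕ.+-mono-≤ (sumSubℕ-mono (h ∘ (false ∷_))) (sumSubℕ-mono (h ∘ (true ∷_)))

sumSubℕ-0 : ∀ {m} → sumSubℕ {m} (λ _ → 0) ≡ 0
sumSubℕ-0 {zero}  = refl
sumSubℕ-0 {suc m} = cong₂ ℕ._+_ (sumSubℕ-0 {m}) (sumSubℕ-0 {m})

sumSubℕ-⊕ : ∀ {m} (f : Subset m → ℕ) T → sumSubℕ (λ S → f (S ⊕ T)) ≡ sumSubℕ f
sumSubℕ-⊕ f []          = refl
sumSubℕ-⊕ f (false ∷ T) =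
  cong₂ ℕ._+_ (sumSubℕ-⊕ (f ∘ (false ∷_)) T) (sumSubℕ-⊕ (f ∘ (true ∷_)) T)
sumSubℕ-⊕ f (true ∷ T)  =
  trans (cong₂ ℕ._+_ (sumSubℕ-⊕ (f ∘ (true ∷_)) T) (sumSubℕ-⊕ (f ∘ (false ∷_)) T))
        (ℕ.+-comm (sumSubℕ (f ∘ (true ∷_))) _)

sumSubℕ-ind-witness : ∀ {m} (P : Subset m → Bool) → sumSubℕ (ind ∘ P) ≢ 0 → ∃ λ S → P S ≡ true
sumSubℕ-ind-witness {zero} P ≢0 with P [] in P[]
... | true  = [] , P[]
... | false = ⊥-elim (≢0 refl)
sumSubℕ-ind-witness {suc m} P ≢0 with sumSubℕ (ind ∘ P ∘ (false ∷_)) ℕ.≟ 0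
... | no  ≢0ˡ = let (S , PS) = sumSubℕ-ind-witness (P ∘ (false ∷_)) ≢0ˡ in false ∷ S , PS
... | yes ≡0ˡ =
  let (S , PS) = sumSubℕ-ind-witness (P ∘ (true ∷_)) (λ ≡0ʳ → ≢0 (cong₂ ℕ._+_ ≡0ˡ ≡0ʳ)) in true ∷ S , PS

sumSubℕ-sumFinℕ : ∀ {m k} (f : Subset m → Fin k → ℕ) →
  sumSubℕ (λ S → sumFinℕ (f S)) ≡ sumFinℕ (λ i → sumSubℕ (λ S → f S i))
sumSubℕ-sumFinℕ {zero}  f = refl
sumSubℕ-sumFinℕ {suc m} {k} f =
  trans (cong₂ ℕ._+_ (sumSubℕ-sumFinℕ (f ∘ (false ∷_))) (sumSubℕ-sumFinℕ (f ∘ (true ∷_))))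
        (sym (sumFinℕ-+ (λ i → sumSubℕ (λ S → f (false ∷ S) i)) (λ i → sumSubℕ (λ S → f (true ∷ S) i))))
  where
  sumFinℕ-+ : ∀ {k} (g h : Fin k → ℕ) → sumFinℕ (λ i → g i ℕ.+ h i) ≡ sumFinℕ g ℕ.+ sumFinℕ h
  sumFinℕ-+ {zero}  g h = refl
  sumFinℕ-+ {suc k} g h = trans (cong (g fz ℕ.+ h fz ℕ.+_) (sumFinℕ-+ (g ∘ fs) (h ∘ fs)))
                                (+-interchange (g fz) (h fz) _ _)

sumSubℕ-*ˡ : ∀ {m} k (f : Subset m → ℕ) → sumSubℕ (λ S → k ℕ.* f S) ≡ k ℕ.* sumSubℕ f
sumSubℕ-*ˡ {zero}  k f = refl
sumSubℕ-*ˡ {suc m} k f =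
  trans (cong₂ ℕ._+_ (sumSubℕ-*ˡ k (f ∘ (false ∷_))) (sumSubℕ-*ˡ k (f ∘ (true ∷_))))
        (sym (ℕ.*-distribˡ-+ k (sumSubℕ (f ∘ (false ∷_))) _))

_≐_ : ∀ {n} → (Fin n → Bool) → (Fin n → Bool) → Bool
f ≐ g = allFin (λ v → not (f v xor g v))

≐-true⁻ : ∀ {n} (f g : Fin n → Bool) → f ≐ g ≡ true → ∀ v → f v ≡ g v
≐-true⁻ f g f≐g v = xnor (f v) (g v) (allFin-true⁻ _ f≐g v)
  where
  xnor : ∀ a b → not (a xor b) ≡ true → a ≡ b
  xnor false false _ = refl
  xnor true  true  _ = refl

≐-true : ∀ {n} (f g : Fin n → Bool) → (∀ v → f v ≡ g v) → f ≐ g ≡ true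
≐-true f g f≗g = allFin-true _ (λ v → subst (λ x → not (f v xor x) ≡ true) (f≗g v) (same (f v)))
  where
  same : ∀ a → not (a xor a) ≡ true
  same false = refl
  same true  = refl

#fibre : ∀ {n m} → Ends n m → Subset m → (Fin n → Bool) → ℕ
#fibre ends R T = sumSubℕ (λ S → ind (S ⊆ᵇ R ∧ (T ≐ ∂ ends S)))

#even : ∀ {n m} → Ends n m → Subset m → ℕ
#even ends R = #fibre ends R (λ _ → false)

module _ {n m} (ends : Ends n m) (R : Subset m) where

  HasBoundary : (Fin n → Bool) → Set
  HasBoundary T = ∃ λ S → S ⊆ᵇ R ≡ true × (∀ v → ∂ ends S v ≡ T v)

  -- ∂ is additive, so translation by a fixed S₀ maps the fibre over T onto the fibre over ∅
  #fibre-translate : ∀ T → HasBoundary T → #fibre ends R T ≡ #even ends R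
  #fibre-translate T (S₀ , S₀⊆R , ∂S₀) = begin
    #fibre ends R T                                            ≡⟨ sumSubℕ-⊕ _ S₀ ⟨
    sumSubℕ (λ S → ind ((S ⊕ S₀) ⊆ᵇ R ∧ (T ≐ ∂ ends (S ⊕ S₀)))) ≡⟨ sumSubℕ-cong shift ⟩
    #even ends R                                               ∎
    where
    open ≡-Reasoning
    shift : ∀ S → ind ((S ⊕ S₀) ⊆ᵇ R ∧ (T ≐ ∂ ends (S ⊕ S₀))) ≡ ind (S ⊆ᵇ R ∧ ((λ _ → false) ≐ ∂ ends S))
    shift S = cong ind (cong₂ _∧_ (⊕-⊆ᵇ S S₀ R S₀⊆R) (allFin-cong λ v → cong not (begin
      T v xor ∂ ends (S ⊕ S₀) v          ≡⟨ cong (T v xor_) (∂-⊕ ends S S₀ v) ⟩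
      T v xor (∂ ends S v xor ∂ ends S₀ v) ≡⟨ cong (λ x → T v xor (∂ ends S v xor x)) (∂S₀ v) ⟩
      T v xor (∂ ends S v xor T v)         ≡⟨ xor-cancel (T v) (∂ ends S v) ⟩
      ∂ ends S v                           ∎)))

  #fibre-witness : ∀ T → #fibre ends R T ≢ 0 → HasBoundary T
  #fibre-witness T ≢0 =
    let (S , PS) = sumSubℕ-ind-witness _ ≢0
        (S⊆R , T≐∂S) = ∧-true⁻ (S ⊆ᵇ R) PS
    in S , S⊆R , λ v → sym (≐-true⁻ T (∂ ends S) T≐∂S v)

  #fibre-≤ : ∀ T → #fibre ends R T ℕ.≤ #even ends R
  #fibre-≤ T with #fibre ends R T ℕ.≟ 0
  ... | yes ≡0 = ℕ.≤-trans (ℕ.≤-reflexive ≡0) ℕ.z≤n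
  ... | no  ≢0 = ℕ.≤-reflexive (#fibre-translate T (#fibre-witness T ≢0))

  #fibre-empty : ∀ T → ¬ HasBoundary T → #fibre ends R T ≡ 0
  #fibre-empty T ¬∂ with #fibre ends R T ℕ.≟ 0
  ... | yes ≡0 = ≡0
  ... | no  ≢0 = ⊥-elim (¬∂ (#fibre-witness T ≢0))

data Walk {n} (A : Fin n → Fin n → Bool) (u : Fin n) : Fin n → Set where
  ε   : Walk A u u
  _▸_ : ∀ {w v} → Walk A u w → A w v ≡ true → Walk A u v

module _ {n} {A : Fin n → Fin n → Bool} where

  _++ʷ_ : ∀ {u w v} → Walk A u w → Walk A w v → Walk A u v
  p ++ʷ ε       = p
  p ++ʷ (q ▸ e) = (p ++ʷ q) ▸ e

  reverseʷ : (∀ x y → A x y ≡ A y x) → ∀ {u v} → Walk A u v → Walk A v u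
  reverseʷ sym-A ε                         = ε
  reverseʷ sym-A {v = v} (_▸_ {w = w} p e) = (ε ▸ trans (sym-A v w) e) ++ʷ reverseʷ sym-A p

  mapʷ : ∀ {B : Fin n → Fin n → Bool} → (∀ x y → A x y ≡ true → B x y ≡ true) →
    ∀ {u v} → Walk A u v → Walk B u v
  mapʷ f ε       = ε
  mapʷ f (p ▸ e) = mapʷ f p ▸ f _ _ e

module Connectivity {n m} (ends : Ends n m) (R : Subset m) where

  reach : ℕ → Fin n → Fin n → Bool
  reach = reachK ends R

  Path : Fin n → Fin n → Set
  Path = Walk (adj ends R)

  reach⇒path : ∀ k {u v} → reach k u v ≡ true → Path u v
  reach⇒path zero {u} {v} r with δ-true {x = u} {v} r
  ... | refl = ε
  reach⇒path (suc k) {u} {v} r with ∨-true⁻ (reach k u v) r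
  ... | inj₁ r′ = reach⇒path k r′
  ... | inj₂ r′ = let (w , rw) = anyFin-true⁻ _ r′
                      (r-uw , e) = ∧-true⁻ (reach k u w) rw
                  in reach⇒path k r-uw ▸ e

  path⇒reach : ∀ {u v} → Path u v → ∃ λ k → reach k u v ≡ true
  path⇒reach {u} ε = 0 , δ-refl u
  path⇒reach (_▸_ {w = w} p e) =
    let (k , r) = path⇒reach p in suc k , ∨-trueʳ _ (anyFin-true _ w (∧-true r e))

  reach-mono : ∀ {k l} → k ℕ.≤ l → ∀ {u v} → reach k u v ≡ true → reach l u v ≡ true
  reach-mono {l = l} k≤l r with ℕ.≤⇒≤′ k≤l
  ... | ℕ.≤′-refl       = r
  ... | ℕ.≤′-step k≤′l = ∨-trueˡ _ (reach-mono (ℕ.≤′⇒≤ k≤′l) r)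

  module _ (u : Fin n) where

    Stable : ℕ → Set
    Stable k = ∀ v → reach (suc k) u v ≡ reach k u v

    stable-suc : ∀ k → Stable k → Stable (suc k)
    stable-suc k st v = begin
      reach (suc k) u v ∨ anyFin (λ w → reach (suc k) u w ∧ adj ends R w v)
        ≡⟨ cong (reach (suc k) u v ∨_) (anyFin-cong λ w → cong (_∧ adj ends R w v) (st w)) ⟩
      (reach k u v ∨ X) ∨ X ≡⟨ Bool.∨-assoc (reach k u v) X X ⟩
      reach k u v ∨ (X ∨ X) ≡⟨ cong (reach k u v ∨_) (Bool.∨-idem X) ⟩
      reach k u v ∨ X       ∎
      where
      open ≡-Reasoning
      X = anyFin (λ w → reach k u w ∧ adj ends R w v)

    stable-+ : ∀ k → Stable k → ∀ d → Stable (d ℕ.+ k)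
    stable-+ k st zero    = st
    stable-+ k st (suc d) = stable-suc (d ℕ.+ k) (stable-+ k st d)

    stable-forever : ∀ k → Stable k → ∀ d v → reach (d ℕ.+ k) u v ≡ reach k u v
    stable-forever k st zero    v = refl
    stable-forever k st (suc d) v = trans (stable-+ k st d v) (stable-forever k st d v)

    grows : ∀ k → ¬ Stable k → countFin (reach k u) ℕ.< countFin (reach (suc k) u)
    grows k unstable =
      let (v , changed) = ¬∀⟶∃¬ n _ (λ v → reach (suc k) u v Bool.≟ reach k u v) unstable
          old : reach k u v ≡ false
          old = ¬-not (λ r → changed (trans (∨-trueˡ _ r) (sym r)))
          new : reach (suc k) u v ≡ true
          new = ¬-not (λ r′ → changed (trans r′ (sym old)))
      in countFin-< (λ w → ∨-trueˡ _) v old new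

    stable-or-large : ∀ k → (∃ λ j → j ℕ.≤ k × Stable j) ⊎ (k ℕ.< countFin (reach k u))
    stable-or-large zero = inj₂ (countFin-pos (reach 0 u) u (δ-refl u))
    stable-or-large (suc k) with stable-or-large k
    ... | inj₁ (j , j≤k , st) = inj₁ (j , ℕ.m≤n⇒m≤1+n j≤k , st)
    ... | inj₂ large with all? (λ v → reach (suc k) u v Bool.≟ reach k u v)
    ...   | yes st       = inj₁ (k , ℕ.n≤1+n k , st)
    ...   | no  unstable = inj₂ (ℕ.<-≤-trans (ℕ.s≤s large) (grows k unstable))

    -- every unstable step adds a reachable vertex, and there are only n vertices
    stable-by-n : ∃ λ j → j ℕ.≤ n × Stable j
    stable-by-n with stable-or-large n
    ... | inj₁ stable = stable
    ... | inj₂ large  = ⊥-elim (ℕ.<⇒≱ large (countFin-≤ (reach n u)))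

    reach⇒connected : ∀ k {v} → reach k u v ≡ true → connected ends R u v ≡ true
    reach⇒connected k {v} r =
      let (j , j≤n , st) = stable-by-n
          l = k ℕ.+ n
          [l∸j]+j≡l = ℕ.m∸n+n≡m (ℕ.≤-trans j≤n (ℕ.m≤n+m n k))
          reach-l : reach l u v ≡ true
          reach-l = reach-mono (ℕ.m≤m+n k n) r
          reach-j : reach j u v ≡ true
          reach-j = trans (sym (stable-forever j st (l ℕ.∸ j) v))
                          (subst (λ i → reach i u v ≡ true) (sym [l∸j]+j≡l) reach-l)
      in reach-mono j≤n reach-j

  path⇒connected : ∀ {u v} → Path u v → connected ends R u v ≡ true
  path⇒connected {u} p = let (k , r) = path⇒reach p in reach⇒connected u k r

  connected⇒path : ∀ {u v} → connected ends R u v ≡ true → Path u v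
  connected⇒path = reach⇒path n

-- Equivalence classes, counted by their least elements

module _ {n : ℕ} where

  _∼[_]_ : Fin n → (Fin n → Fin n → Bool) → Fin n → Set
  x ∼[ c ] y = c x y ≡ true

  isLeast : (Fin n → Fin n → Bool) → Fin n → Bool
  isLeast c v = allFin (λ u → not ((toℕ u <ᵇ toℕ v) ∧ c u v))

  #classes : (Fin n → Fin n → Bool) → ℕ
  #classes c = countFin (isLeast c)

  isLeast-true⁻ : ∀ c {v} → isLeast c v ≡ true → ∀ u → toℕ u ℕ.< toℕ v → c u v ≡ false
  isLeast-true⁻ c {v} least u u<v =
    Bool.not-injective (subst (λ b → not (b ∧ c u v) ≡ true) (Equivalence.to Bool.T-≡ (ℕ.<⇒<ᵇ u<v))
                              (allFin-true⁻ _ least u))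

  isLeast-true : ∀ c {v} → (∀ u → toℕ u ℕ.< toℕ v → c u v ≡ false) → isLeast c v ≡ true
  isLeast-true c {v} h = allFin-true _ λ u → check u (toℕ u <ᵇ toℕ v) refl
    where
    check : ∀ u b → (toℕ u <ᵇ toℕ v) ≡ b → not (b ∧ c u v) ≡ true
    check u false _  = refl
    check u true  lt = cong not (h u (ℕ.<ᵇ⇒< (toℕ u) (toℕ v) (Equivalence.from Bool.T-≡ lt)))

  isLeast-antitone : ∀ {c c′} → (∀ {x y} → x ∼[ c ] y → x ∼[ c′ ] y) →
    ∀ {v} → isLeast c′ v ≡ true → isLeast c v ≡ true
  isLeast-antitone {c} {c′} c⊆c′ least′ =
    isLeast-true c λ u u<v → ¬-not λ cuv → true≢false (c⊆c′ cuv) (isLeast-true⁻ c′ least′ u u<v)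

  Joins : (c c′ : Fin n → Fin n → Bool) → Fin n → Fin n → Set
  Joins c c′ a b = ∀ {x y} → x ∼[ c′ ] y →
    x ∼[ c ] y ⊎ (x ∼[ c ] a × b ∼[ c ] y) ⊎ (x ∼[ c ] b × a ∼[ c ] y)

  Joins-sym : ∀ {c c′ a b} → Joins c c′ a b → Joins c c′ b a
  Joins-sym join x∼′y with join x∼′y
  ... | inj₁ x∼y         = inj₁ x∼y
  ... | inj₂ (inj₁ via) = inj₂ (inj₂ via)
  ... | inj₂ (inj₂ via) = inj₂ (inj₁ via)

module Merge {n} {c c′ : Fin n → Fin n → Bool}
  (eqv : IsEquivalence (_∼[ c ]_)) (eqv′ : IsEquivalence (_∼[ c′ ]_))
  (c⊆c′ : ∀ {x y} → x ∼[ c ] y → x ∼[ c′ ] y) where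

  open IsEquivalence eqv renaming (refl to ∼-refl; sym to ∼-sym; trans to ∼-trans)
  open IsEquivalence eqv′ using () renaming (sym to ∼′-sym; trans to ∼′-trans)

  LeastOf : Fin n → Fin n → Set
  LeastOf x r = r ∼[ c ] x × (∀ u → toℕ u ℕ.< toℕ r → c u x ≡ false)

  leastOf : ∀ x → ∃ (LeastOf x)
  leastOf x = let (r , r∼x , below) = least-true (λ u → c u x) x ∼-refl in r , r∼x , below

  leastOf-isLeast : ∀ {x r} → LeastOf x r → isLeast c r ≡ true
  leastOf-isLeast (r∼x , below) =
    isLeast-true c λ u u<r → ¬-not λ u∼r → true≢false (∼-trans u∼r r∼x) (below u u<r)

  leastOf-unique : ∀ {v x r} → isLeast c v ≡ true → v ∼[ c ] x → LeastOf x r → v ≡ r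
  leastOf-unique {v} {x} {r} least v∼x (r∼x , below) with ℕ.<-cmp (toℕ v) (toℕ r)
  ... | tri< v<r _ _ = ⊥-elim (true≢false v∼x (below v v<r))
  ... | tri≈ _ v≡r _ = toℕ-injective v≡r
  ... | tri> _ _ r<v = ⊥-elim (true≢false (∼-trans r∼x (∼-sym v∼x)) (isLeast-true⁻ c least r r<v))

  #classes-connected : ∀ {a b} → Joins c c′ a b → a ∼[ c ] b → #classes c′ ≡ #classes c
  #classes-connected {a} {b} join a∼b =
    countFin-cong λ v → allFin-cong λ u →
      cong (λ z → not ((toℕ u <ᵇ toℕ v) ∧ z)) (bool-ext (to ∘ join) (c⊆c′ {u} {v}))
    where
    to : ∀ {x y} → x ∼[ c ] y ⊎ (x ∼[ c ] a × b ∼[ c ] y) ⊎ (x ∼[ c ] b × a ∼[ c ] y) → x ∼[ c ] y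
    to (inj₁ x∼y)                = x∼y
    to (inj₂ (inj₁ (x∼a , b∼y))) = ∼-trans x∼a (∼-trans a∼b b∼y)
    to (inj₂ (inj₂ (x∼b , a∼y))) = ∼-trans x∼b (∼-trans (∼-sym a∼b) a∼y)

  -- after the merge, the larger of the two class minima r₁ < r₂ is no longer least
  #classes-merge : ∀ {a b r₁ r₂} → Joins c c′ a b → a ∼[ c′ ] b →
    LeastOf a r₁ → LeastOf b r₂ → toℕ r₁ ℕ.< toℕ r₂ → #classes c ≡ suc (#classes c′)
  #classes-merge {a} {b} {r₁} {r₂} join a∼′b least₁ least₂ r₁<r₂ =
    trans (countFin-remove (isLeast c) r₂ (leastOf-isLeast least₂)) (cong suc (sym (countFin-cong pointwise)))
    where
    r₁∼′r₂ : r₁ ∼[ c′ ] r₂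
    r₁∼′r₂ = ∼′-trans (c⊆c′ (proj₁ least₁)) (∼′-trans a∼′b (c⊆c′ (∼-sym (proj₁ least₂))))
    survives : ∀ {v} → isLeast c v ≡ true → v ≢ r₂ → isLeast c′ v ≡ true
    survives {v} least v≢r₂ = isLeast-true c′ λ u u<v → ¬-not λ u∼′v → case u u<v (join u∼′v)
      where
      case : ∀ u → toℕ u ℕ.< toℕ v → u ∼[ c ] v ⊎ (u ∼[ c ] a × b ∼[ c ] v) ⊎ (u ∼[ c ] b × a ∼[ c ] v) → ⊥
      case u u<v (inj₁ u∼v)                = true≢false u∼v (isLeast-true⁻ c least u u<v)
      case u u<v (inj₂ (inj₁ (_ , b∼v)))   = v≢r₂ (leastOf-unique least (∼-sym b∼v) least₂)
      case u u<v (inj₂ (inj₂ (u∼b , a∼v))) with leastOf-unique least (∼-sym a∼v) least₁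
      ... | refl = true≢false u∼b (proj₂ least₂ u (ℕ.<-trans u<v r₁<r₂))
    pointwise : ∀ v → isLeast c′ v ≡ isLeast c v xor δ r₂ v
    pointwise v with r₂ ≟ᶠ v
    ... | yes refl = trans (¬-not λ least′ → true≢false r₁∼′r₂ (isLeast-true⁻ c′ least′ r₁ r₁<r₂))
                           (cong (_xor true) (sym (leastOf-isLeast least₂)))
    ... | no r₂≢v  = trans (bool-ext (isLeast-antitone {c = c} {c′ = c′} c⊆c′ {v})
                                     (λ least → survives least (r₂≢v ∘ sym)))
                           (sym (Bool.xor-identityʳ _))

  #classes-separate : ∀ {a b} → Joins c c′ a b → a ∼[ c′ ] b → c a b ≡ false →
    #classes c ≡ suc (#classes c′)
  #classes-separate {a} {b} join a∼′b a≁b with leastOf a | leastOf b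
  ... | r₁ , least₁ | r₂ , least₂ with ℕ.<-cmp (toℕ r₁) (toℕ r₂)
  ... | tri< r₁<r₂ _ _ = #classes-merge join a∼′b least₁ least₂ r₁<r₂
  ... | tri> _ _ r₂<r₁ = #classes-merge (Joins-sym {a = a} {b} join) (∼′-sym a∼′b) least₂ least₁ r₂<r₁
  ... | tri≈ _ r₁≡r₂ _ with toℕ-injective {i = r₁} {j = r₂} r₁≡r₂
  ...   | refl = ⊥-elim (true≢false (∼-trans (∼-sym (proj₁ least₁)) (proj₁ least₂)) a≁b)

xorFin : ∀ {k} → (Fin k → Bool) → Bool
xorFin {zero}  f = false
xorFin {suc k} f = f fz xor xorFin (f ∘ fs)

parityOn : ∀ {k} → (Fin k → Bool) → (Fin k → Bool) → Bool
parityOn C T = xorFin (λ w → C w ∧ T w)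

parityOn-cong : ∀ {k} (C : Fin k → Bool) {T T′} → (∀ w → T w ≡ T′ w) → parityOn C T ≡ parityOn C T′
parityOn-cong {zero}  C h = refl
parityOn-cong {suc k} C h = cong₂ _xor_ (cong (C fz ∧_) (h fz)) (parityOn-cong (C ∘ fs) (h ∘ fs))

parityOn-false : ∀ {k} (C : Fin k → Bool) → parityOn C (λ _ → false) ≡ false
parityOn-false {zero}  C = refl
parityOn-false {suc k} C =
  trans (cong (_xor parityOn (C ∘ fs) (λ _ → false)) (Bool.∧-zeroʳ (C fz))) (parityOn-false (C ∘ fs))

parityOn-xor : ∀ {k} (C T T′ : Fin k → Bool) →
  parityOn C (λ w → T w xor T′ w) ≡ parityOn C T xor parityOn C T′
parityOn-xor {zero}  C T T′ = refl
parityOn-xor {suc k} C T T′ = begin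
  (C fz ∧ (T fz xor T′ fz)) xor parityOn (C ∘ fs) (λ w → T (fs w) xor T′ (fs w))
    ≡⟨ cong₂ _xor_ (Bool.∧-distribˡ-xor (C fz) (T fz) (T′ fz)) (parityOn-xor (C ∘ fs) (T ∘ fs) (T′ ∘ fs)) ⟩
  ((C fz ∧ T fz) xor (C fz ∧ T′ fz)) xor (parityOn (C ∘ fs) (T ∘ fs) xor parityOn (C ∘ fs) (T′ ∘ fs))
    ≡⟨ xor-interchange (C fz ∧ T fz) _ _ _ ⟩
  parityOn C T xor parityOn C T′ ∎
  where open ≡-Reasoning

parityOn-δ : ∀ {k} (C : Fin k → Bool) x → parityOn C (δ x) ≡ C x
parityOn-δ C fz     =
  trans (cong₂ _xor_ (Bool.∧-identityʳ (C fz)) (parityOn-false (C ∘ fs))) (Bool.xor-identityʳ (C fz))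
parityOn-δ C (fs x) =
  trans (cong (_xor parityOn (C ∘ fs) (δ x)) (Bool.∧-zeroʳ (C fz))) (parityOn-δ (C ∘ fs) x)

parityOn-pair : ∀ {k} (C : Fin k → Bool) x y → parityOn C (λ w → δ x w xor δ y w) ≡ C x xor C y
parityOn-pair C x y = trans (parityOn-xor C (δ x) (δ y)) (cong₂ _xor_ (parityOn-δ C x) (parityOn-δ C y))

-- the handshake lemma, restricted to a union of components
∂-even-on-closed : ∀ {n m} (ends : Ends n m) (C : Fin n → Bool) R →
  (∀ e → lookup R e ≡ true → C (proj₁ (ends e)) ≡ C (proj₂ (ends e))) →
  ∀ S → S ⊆ᵇ R ≡ true → parityOn C (∂ ends S) ≡ false
∂-even-on-closed ends C []      closed []      _   = parityOn-false C
∂-even-on-closed ends C (r ∷ R) closed (s ∷ S) s∷S⊆R =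
  trans (parityOn-xor C (λ w → s ∧ ∂ₑ ends fz w) (∂ (ends ∘ fs) S))
        (cong₂ _xor_ (first s (proj₁ (∧-true⁻ (not s ∨ r) s∷S⊆R)))
                     (∂-even-on-closed (ends ∘ fs) C R (closed ∘ fs) S (proj₂ (∧-true⁻ (not s ∨ r) s∷S⊆R))))
  where
  first : ∀ s → not s ∨ r ≡ true → parityOn C (λ w → s ∧ ∂ₑ ends fz w) ≡ false
  first false _ = parityOn-false C
  first true  r≡true = begin
    parityOn C (∂ₑ ends fz)
      ≡⟨ parityOn-pair C (proj₁ (ends fz)) (proj₂ (ends fz)) ⟩
    C (proj₁ (ends fz)) xor C (proj₂ (ends fz))
      ≡⟨ cong (_xor C (proj₂ (ends fz))) (closed fz r≡true) ⟩
    C (proj₂ (ends fz)) xor C (proj₂ (ends fz))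
      ≡⟨ Bool.xor-same (C (proj₂ (ends fz))) ⟩
    false ∎
    where open ≡-Reasoning

module _ {n m} (ends : Ends n m) where

  adj-sym : ∀ R u v → adj ends R u v ≡ adj ends R v u
  adj-sym R u v = anyFin-cong λ e →
    cong (lookup R e ∧_) (Bool.∨-comm (δ (proj₁ (ends e)) u ∧ δ (proj₂ (ends e)) v) _)

  adj-edge : ∀ R e → lookup R e ≡ true → adj ends R (proj₁ (ends e)) (proj₂ (ends e)) ≡ true
  adj-edge R e Re =
    anyFin-true _ e (∧-true Re (∨-trueˡ _ (∧-true (δ-refl (proj₁ (ends e))) (δ-refl (proj₂ (ends e))))))

  adj-true⁻ : ∀ R w v → adj ends R w v ≡ true →
    ∃ λ e → lookup R e ≡ true × (∀ z → ∂ₑ ends e z ≡ δ w z xor δ v z)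
  adj-true⁻ R w v wv with anyFin-true⁻ _ wv
  ... | e , Re∧ends with ∧-true⁻ (lookup R e) Re∧ends
  ... | Re , ends≡ with ∨-true⁻ (δ (proj₁ (ends e)) w ∧ δ (proj₂ (ends e)) v) ends≡
  ... | inj₁ forward with ∧-true⁻ (δ (proj₁ (ends e)) w) forward
  ...   | a≡w , b≡v with δ-true {x = proj₁ (ends e)} a≡w | δ-true {x = proj₂ (ends e)} b≡v
  ...     | refl | refl = e , Re , λ z → refl
  adj-true⁻ R w v wv | e , _ | Re , _ | inj₂ backward with ∧-true⁻ (δ (proj₁ (ends e)) v) backward
  ...   | a≡v , b≡w with δ-true {x = proj₁ (ends e)} a≡v | δ-true {x = proj₂ (ends e)} b≡w
  ...     | refl | refl = e , Re , λ z → Bool.xor-comm (δ v z) (δ w z)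

  module _ (R : Subset m) where
    open Connectivity ends R

    connected-isEquivalence : IsEquivalence (_∼[ connected ends R ]_)
    connected-isEquivalence = record
      { refl  = λ {x} → path⇒connected (ε {u = x})
      ; sym   = λ x∼y → path⇒connected (reverseʷ (adj-sym R) (connected⇒path x∼y))
      ; trans = λ x∼y y∼z → path⇒connected (connected⇒path x∼y ++ʷ connected⇒path y∼z)
      }

    path-boundary : ∀ {u v} → Path u v → HasBoundary ends R (λ z → δ u z xor δ v z)
    path-boundary {u} ε = ∅ , ∅⊆ᵇ R , λ z → trans (∂-∅ ends z) (sym (Bool.xor-same (δ u z)))
    path-boundary {u} (_▸_ {w = w} {v = v} p wv) =
      let (S , S⊆R , ∂S) = path-boundary p
          (e , Re , ∂e) = adj-true⁻ R w v wv
      in S ⊕ ⁅ e ⁆ ,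
         trans (⊕-⊆ᵇ S ⁅ e ⁆ R (⁅⁆⊆ᵇ R e Re)) S⊆R ,
         λ z → begin
           ∂ ends (S ⊕ ⁅ e ⁆) z
             ≡⟨ ∂-⊕ ends S ⁅ e ⁆ z ⟩
           ∂ ends S z xor ∂ ends ⁅ e ⁆ z
             ≡⟨ cong₂ _xor_ (∂S z) (trans (∂-⁅⁆ ends e z) (∂e z)) ⟩
           (δ u z xor δ w z) xor (δ w z xor δ v z)
             ≡⟨ xor-chain (δ u z) (δ w z) (δ v z) ⟩
           δ u z xor δ v z ∎
      where open ≡-Reasoning

    connected-closed : ∀ x e → lookup R e ≡ true →
      connected ends R x (proj₁ (ends e)) ≡ connected ends R x (proj₂ (ends e))
    connected-closed x e Re = bool-ext (λ x∼a → ∼-trans x∼a a∼b) (λ x∼b → ∼-trans x∼b (∼-sym a∼b))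
      where
      open IsEquivalence connected-isEquivalence renaming (sym to ∼-sym; trans to ∼-trans)
      a∼b = path⇒connected (ε ▸ adj-edge R e Re)

  connected-cong : ∀ {m′} (ends′ : Ends n m′) R R′ → (∀ u v → adj ends R u v ≡ adj ends′ R′ u v) →
    ∀ u v → connected ends R u v ≡ connected ends′ R′ u v
  connected-cong ends′ R R′ adj≗ u v = reach-cong n v
    where
    reach-cong : ∀ k v → reachK ends R k u v ≡ reachK ends′ R′ k u v
    reach-cong zero    v = refl
    reach-cong (suc k) v = cong₂ _∨_ (reach-cong k v) (anyFin-cong λ w → cong₂ _∧_ (reach-cong k w) (adj≗ w v))

  κ-cong : ∀ {m′} (ends′ : Ends n m′) R R′ → (∀ u v → adj ends R u v ≡ adj ends′ R′ u v) →
    κ ends R ≡ κ ends′ R′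
  κ-cong ends′ R R′ adj≗ = countFin-cong λ v → allFin-cong λ u →
    cong (λ z → not ((toℕ u <ᵇ toℕ v) ∧ z)) (connected-cong ends′ R R′ adj≗ u v)

κ-∅ : ∀ {n} (ends : Ends n 0) → κ ends [] ≡ n
κ-∅ {n} ends = countFin-all _ λ v → isLeast-true (connected ends []) λ u u<v →
  ¬-not λ u∼v → ℕ.<-irrefl (cong toℕ (edgeless (Connectivity.connected⇒path ends [] u∼v))) u<v
  where
  edgeless : ∀ {u v} → Walk (adj ends []) u v → u ≡ v
  edgeless ε = refl

-- The cycle space of (V, R) has dimension |R| - n + κ(R)

#even-∷false : ∀ {n m} (ends : Ends n (suc m)) R₀ → #even ends (false ∷ R₀) ≡ #even (ends ∘ fs) R₀
#even-∷false {m = m} ends R₀ =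
  trans (cong (#even (ends ∘ fs) R₀ ℕ.+_) (sumSubℕ-0 {m})) (ℕ.+-identityʳ _)

#even-∷true : ∀ {n m} (ends : Ends n (suc m)) R₀ →
  #even ends (true ∷ R₀) ≡ #even (ends ∘ fs) R₀ ℕ.+ #fibre (ends ∘ fs) R₀ (∂ₑ ends fz)
#even-∷true ends R₀ = refl

module AddEdge {n m} (ends : Ends n (suc m)) (R₀ : Subset m) where

  a b : Fin n
  a = proj₁ (ends fz)
  b = proj₂ (ends fz)

  c c′ : Fin n → Fin n → Bool
  c  = connected (ends ∘ fs) R₀
  c′ = connected ends (true ∷ R₀)

  open IsEquivalence (connected-isEquivalence (ends ∘ fs) R₀)
    renaming (refl to ∼-refl; sym to ∼-sym; trans to ∼-trans)
  open Connectivity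

  c⊆c′ : ∀ {x y} → x ∼[ c ] y → x ∼[ c′ ] y
  c⊆c′ = path⇒connected ends (true ∷ R₀) ∘ mapʷ (λ _ _ → ∨-trueʳ _) ∘ connected⇒path (ends ∘ fs) R₀

  a∼′b : a ∼[ c′ ] b
  a∼′b = path⇒connected ends (true ∷ R₀) (ε ▸ adj-edge ends (true ∷ R₀) fz refl)

  Via : Fin n → Fin n → Set
  Via x y = x ∼[ c ] y ⊎ (x ∼[ c ] a × b ∼[ c ] y) ⊎ (x ∼[ c ] b × a ∼[ c ] y)

  via-old : ∀ {x w y} → Via x w → w ∼[ c ] y → Via x y
  via-old (inj₁ x∼w)              w∼y = inj₁ (∼-trans x∼w w∼y)
  via-old (inj₂ (inj₁ (x∼a , b∼w))) w∼y = inj₂ (inj₁ (x∼a , ∼-trans b∼w w∼y))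
  via-old (inj₂ (inj₂ (x∼b , a∼w))) w∼y = inj₂ (inj₂ (x∼b , ∼-trans a∼w w∼y))

  via-ab : ∀ {x} → Via x a → Via x b
  via-ab (inj₁ x∼a)              = inj₂ (inj₁ (x∼a , ∼-refl))
  via-ab (inj₂ (inj₁ (x∼a , _))) = inj₂ (inj₁ (x∼a , ∼-refl))
  via-ab (inj₂ (inj₂ (x∼b , _))) = inj₁ x∼b

  via-ba : ∀ {x} → Via x b → Via x a
  via-ba (inj₁ x∼b)              = inj₂ (inj₂ (x∼b , ∼-refl))
  via-ba (inj₂ (inj₁ (x∼a , _))) = inj₁ x∼a
  via-ba (inj₂ (inj₂ (x∼b , _))) = inj₂ (inj₂ (x∼b , ∼-refl))

  via : ∀ {x y} → Path ends (true ∷ R₀) x y → Via x y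
  via ε = inj₁ ∼-refl
  via (_▸_ {w = w} {v = y} p wy) with ∨-true⁻ ((δ a w ∧ δ b y) ∨ (δ a y ∧ δ b w)) wy
  ... | inj₂ old = via-old (via p) (path⇒connected (ends ∘ fs) R₀ (ε ▸ old))
  ... | inj₁ new with ∨-true⁻ (δ a w ∧ δ b y) new
  ...   | inj₁ ab
    with δ-true {x = a} (proj₁ (∧-true⁻ (δ a w) ab)) | δ-true {x = b} (proj₂ (∧-true⁻ (δ a w) ab))
  ...     | refl | refl = via-ab (via p)
  via (_▸_ {w = w} {v = y} p wy) | inj₁ new | inj₂ ba
    with δ-true {x = a} (proj₁ (∧-true⁻ (δ a y) ba)) | δ-true {x = b} (proj₂ (∧-true⁻ (δ a y) ba))
  ... | refl | refl = via-ba (via p)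

  joins : Joins c c′ a b
  joins = via ∘ connected⇒path ends (true ∷ R₀)

  open Merge (connected-isEquivalence (ends ∘ fs) R₀) (connected-isEquivalence ends (true ∷ R₀)) c⊆c′
    using (#classes-connected; #classes-separate)

  #fibre-connected : a ∼[ c ] b → #fibre (ends ∘ fs) R₀ (∂ₑ ends fz) ≡ #even (ends ∘ fs) R₀
  #fibre-connected a∼b =
    #fibre-translate (ends ∘ fs) R₀ _ (path-boundary (ends ∘ fs) R₀ (connected⇒path (ends ∘ fs) R₀ a∼b))

  -- the component of a would contain an odd number of odd vertices
  #fibre-separate : c a b ≡ false → #fibre (ends ∘ fs) R₀ (∂ₑ ends fz) ≡ 0
  #fibre-separate a≁b = #fibre-empty (ends ∘ fs) R₀ _ λ (S , S⊆R₀ , ∂S) → true≢false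
    (trans (parityOn-cong (c a) ∂S) (trans (parityOn-pair (c a) a b) (cong₂ _xor_ ∼-refl a≁b)))
    (∂-even-on-closed (ends ∘ fs) (c a) R₀ (connected-closed (ends ∘ fs) R₀ a) S S⊆R₀)

  #even-cycleSpace-step : let s = size (ends ∘ fs) R₀ in
    #even (ends ∘ fs) R₀ ℕ.* 2 ℕ.^ n ≡ 2 ℕ.^ (s ℕ.+ κ (ends ∘ fs) R₀) →
    #even ends (true ∷ R₀) ℕ.* 2 ℕ.^ n ≡ 2 ℕ.^ (suc s ℕ.+ κ ends (true ∷ R₀))
  #even-cycleSpace-step IH with c a b in ab
  ... | true  = begin
    #even ends (true ∷ R₀) ℕ.* 2 ℕ.^ n
      ≡⟨ cong (ℕ._* 2 ℕ.^ n) (#even-∷true ends R₀) ⟩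
    (E ℕ.+ #fibre (ends ∘ fs) R₀ (∂ₑ ends fz)) ℕ.* 2 ℕ.^ n
      ≡⟨ cong (λ F → (E ℕ.+ F) ℕ.* 2 ℕ.^ n) (#fibre-connected ab) ⟩
    (E ℕ.+ E) ℕ.* 2 ℕ.^ n
      ≡⟨ double E (2 ℕ.^ n) ⟩
    2 ℕ.* (E ℕ.* 2 ℕ.^ n)
      ≡⟨ cong (2 ℕ.*_) IH ⟩
    2 ℕ.* 2 ℕ.^ (s ℕ.+ κ (ends ∘ fs) R₀)
      ≡⟨ cong (λ k → 2 ℕ.* 2 ℕ.^ (s ℕ.+ k)) (#classes-connected joins ab) ⟨
    2 ℕ.^ (suc s ℕ.+ κ ends (true ∷ R₀)) ∎
    where
    open ≡-Reasoning
    E = #even (ends ∘ fs) R₀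
    s = size (ends ∘ fs) R₀
    double : ∀ x y → (x ℕ.+ x) ℕ.* y ≡ 2 ℕ.* (x ℕ.* y)
    double x y = trans (ℕ.*-distribʳ-+ y x x) (cong (x ℕ.* y ℕ.+_) (sym (ℕ.+-identityʳ (x ℕ.* y))))
  ... | false = begin
    #even ends (true ∷ R₀) ℕ.* 2 ℕ.^ n
      ≡⟨ cong (ℕ._* 2 ℕ.^ n) (#even-∷true ends R₀) ⟩
    (E ℕ.+ #fibre (ends ∘ fs) R₀ (∂ₑ ends fz)) ℕ.* 2 ℕ.^ n
      ≡⟨ cong (λ F → (E ℕ.+ F) ℕ.* 2 ℕ.^ n) (#fibre-separate ab) ⟩
    (E ℕ.+ 0) ℕ.* 2 ℕ.^ n
      ≡⟨ cong (ℕ._* 2 ℕ.^ n) (ℕ.+-identityʳ E) ⟩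
    E ℕ.* 2 ℕ.^ n
      ≡⟨ IH ⟩
    2 ℕ.^ (s ℕ.+ κ (ends ∘ fs) R₀)
      ≡⟨ cong (λ k → 2 ℕ.^ (s ℕ.+ k)) (#classes-separate joins a∼′b ab) ⟩
    2 ℕ.^ (s ℕ.+ suc (κ ends (true ∷ R₀)))
      ≡⟨ cong (2 ℕ.^_) (ℕ.+-suc s _) ⟩
    2 ℕ.^ (suc s ℕ.+ κ ends (true ∷ R₀)) ∎
    where
    open ≡-Reasoning
    E = #even (ends ∘ fs) R₀
    s = size (ends ∘ fs) R₀

#even-cycleSpace : ∀ {n m} (ends : Ends n m) R →
  #even ends R ℕ.* 2 ℕ.^ n ≡ 2 ℕ.^ (size ends R ℕ.+ κ ends R)
#even-cycleSpace {n} ends [] = begin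
  ind (allFin {n} (λ _ → true)) ℕ.* 2 ℕ.^ n
    ≡⟨ cong (λ b → ind b ℕ.* 2 ℕ.^ n) (allFin-true {n} _ (λ _ → refl)) ⟩
  1 ℕ.* 2 ℕ.^ n
    ≡⟨ ℕ.*-identityˡ _ ⟩
  2 ℕ.^ n
    ≡⟨ cong (2 ℕ.^_) (κ-∅ ends) ⟨
  2 ℕ.^ κ ends [] ∎
  where open ≡-Reasoning
#even-cycleSpace {n} ends (false ∷ R₀) = begin
  #even ends (false ∷ R₀) ℕ.* 2 ℕ.^ n
    ≡⟨ cong (ℕ._* 2 ℕ.^ n) (#even-∷false ends R₀) ⟩
  #even (ends ∘ fs) R₀ ℕ.* 2 ℕ.^ n
    ≡⟨ #even-cycleSpace (ends ∘ fs) R₀ ⟩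
  2 ℕ.^ (size (ends ∘ fs) R₀ ℕ.+ κ (ends ∘ fs) R₀)
    ≡⟨ cong (λ k → 2 ℕ.^ (size (ends ∘ fs) R₀ ℕ.+ k)) (κ-cong (ends ∘ fs) ends R₀ (false ∷ R₀) (λ _ _ → refl)) ⟩
  2 ℕ.^ (size ends (false ∷ R₀) ℕ.+ κ ends (false ∷ R₀)) ∎
  where open ≡-Reasoning
#even-cycleSpace ends (true ∷ R₀) =
  AddEdge.#even-cycleSpace-step ends R₀ (#even-cycleSpace (ends ∘ fs) R₀)

-- Subgraphs with exactly two odd vertices

#twoOdd : ∀ {n m} → Ends n m → Subset m → ℕ
#twoOdd ends R = sumSubℕ (λ S → ind (S ⊆ᵇ R ∧ (countFin (∂ ends S) ≡ᵇ 2)))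

module _ {n m} (ends : Ends n m) (R : Subset m) where

  hasEnds : Fin n → Fin n → Subset m → ℕ
  hasEnds u v S = ind (S ⊆ᵇ R ∧ ((λ w → δ u w xor δ v w) ≐ ∂ ends S))

  -- each odd vertex u of S is paired with the other odd vertex v
  twoOdd≤#ends : ∀ S → 2 ℕ.* ind (S ⊆ᵇ R ∧ (countFin (∂ ends S) ≡ᵇ 2)) ℕ.≤
                       sumFinℕ (λ u → sumFinℕ (λ v → hasEnds u v S))
  twoOdd≤#ends S = bound _ refl
    where
    bound : ∀ b → S ⊆ᵇ R ∧ (countFin (∂ ends S) ≡ᵇ 2) ≡ b →
      2 ℕ.* ind b ℕ.≤ sumFinℕ (λ u → sumFinℕ (λ v → hasEnds u v S))
    bound false _    = ℕ.z≤n
    bound true  S∈E₂ = begin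
      2                                            ≡⟨ two ⟨
      countFin (∂ ends S)                          ≡⟨ countFin≡sumFinℕ (∂ ends S) ⟩
      sumFinℕ (λ u → ind (∂ ends S u))             ≤⟨ sumFinℕ-mono partner ⟩
      sumFinℕ (λ u → sumFinℕ (λ v → hasEnds u v S)) ∎
      where
      open ℕ.≤-Reasoning
      S⊆R = proj₁ (∧-true⁻ (S ⊆ᵇ R) S∈E₂)
      two = ℕ.≡ᵇ⇒≡ _ 2 (Equivalence.from Bool.T-≡ (proj₂ (∧-true⁻ (S ⊆ᵇ R) S∈E₂)))
      partner : ∀ u → ind (∂ ends S u) ℕ.≤ sumFinℕ (λ v → hasEnds u v S)
      partner u with ∂ ends S u in odd-u
      ... | false = ℕ.z≤n
      ... | true  =
        let (v , rest≡δv) = countFin-one _ (ℕ.suc-injective (trans (sym (countFin-remove (∂ ends S) u odd-u)) two))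
            ends≐∂S = ≐-true (λ w → δ u w xor δ v w) (∂ ends S) λ w →
              trans (cong (δ u w xor_) (sym (rest≡δv w))) (xor-cancel (δ u w) (∂ ends S w))
        in ℕ.≤-trans (ℕ.≤-reflexive (sym (cong ind (cong₂ _∧_ S⊆R ends≐∂S)))) (sumFinℕ-single _ v)

  #twoOdd-bound : 2 ℕ.* #twoOdd ends R ℕ.≤ n ℕ.* (n ℕ.* #even ends R)
  #twoOdd-bound = begin
    2 ℕ.* #twoOdd ends R
      ≡⟨ sumSubℕ-*ˡ 2 (λ S → ind (S ⊆ᵇ R ∧ (countFin (∂ ends S) ≡ᵇ 2))) ⟨
    sumSubℕ (λ S → 2 ℕ.* ind (S ⊆ᵇ R ∧ (countFin (∂ ends S) ≡ᵇ 2)))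
      ≤⟨ sumSubℕ-mono twoOdd≤#ends ⟩
    sumSubℕ (λ S → sumFinℕ (λ u → sumFinℕ (λ v → hasEnds u v S)))
      ≡⟨ sumSubℕ-sumFinℕ (λ S u → sumFinℕ (λ v → hasEnds u v S)) ⟩
    sumFinℕ (λ u → sumSubℕ (λ S → sumFinℕ (λ v → hasEnds u v S)))
      ≡⟨ sumFinℕ-cong (λ u → sumSubℕ-sumFinℕ (λ S v → hasEnds u v S)) ⟩
    sumFinℕ (λ u → sumFinℕ (λ v → #fibre ends R (λ w → δ u w xor δ v w)))
      ≤⟨ sumFinℕ-mono {n} (λ u → sumFinℕ-mono {n} (λ v → #fibre-≤ ends R (λ w → δ u w xor δ v w))) ⟩
    sumFinℕ {n} (λ _ → sumFinℕ {n} (λ _ → #even ends R))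
      ≡⟨ trans (sumFinℕ-cong {n} (λ u → sumFinℕ-const n (#even ends R))) (sumFinℕ-const n _) ⟩
    n ℕ.* (n ℕ.* #even ends R) ∎
    where open ℕ.≤-Reasoning

open +-*-Solver using (solve; _:+_; _:*_; _:-_; _:=_; con)

0≤1 : 0ℚ ≤ 1ℚ
0≤1 = ℚ.<⇒≤ (ℚ.positive⁻¹ 1ℚ)

0≤* : ∀ {a b} → 0ℚ ≤ a → 0ℚ ≤ b → 0ℚ ≤ a * b
0≤* {a} {b} 0≤a 0≤b =
  ℚ.nonNegative⁻¹ (a * b) {{ℚ.nonNeg*nonNeg⇒nonNeg a {{nonNegative 0≤a}} b {{nonNegative 0≤b}}}}

*-monoˡ-≤-0≤ : ∀ {r a b} → 0ℚ ≤ r → a ≤ b → r * a ≤ r * b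
*-monoˡ-≤-0≤ {r} 0≤r = ℚ.*-monoˡ-≤-nonNeg r {{nonNegative 0≤r}}

*-monoʳ-≤-0≤ : ∀ {r a b} → 0ℚ ≤ r → a ≤ b → a * r ≤ b * r
*-monoʳ-≤-0≤ {r} 0≤r = ℚ.*-monoʳ-≤-nonNeg r {{nonNegative 0≤r}}

fromℕ-+ : ∀ a b → fromℕ (a ℕ.+ b) ≡ fromℕ a + fromℕ b
fromℕ-+ zero    b = sym (ℚ.+-identityˡ (fromℕ b))
fromℕ-+ (suc a) b = trans (cong (1ℚ +_) (fromℕ-+ a b)) (sym (ℚ.+-assoc 1ℚ (fromℕ a) (fromℕ b)))

fromℕ-* : ∀ a b → fromℕ (a ℕ.* b) ≡ fromℕ a * fromℕ b
fromℕ-* zero    b = sym (ℚ.*-zeroˡ (fromℕ b))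
fromℕ-* (suc a) b = begin
  fromℕ (b ℕ.+ a ℕ.* b)
    ≡⟨ fromℕ-+ b (a ℕ.* b) ⟩
  fromℕ b + fromℕ (a ℕ.* b)
    ≡⟨ cong (fromℕ b +_) (fromℕ-* a b) ⟩
  fromℕ b + fromℕ a * fromℕ b
    ≡⟨ solve 2 (λ x y → y :+ x :* y := (con 1ℚ :+ x) :* y) refl (fromℕ a) (fromℕ b) ⟩
  (1ℚ + fromℕ a) * fromℕ b ∎
  where open ≡-Reasoning

0≤fromℕ : ∀ a → 0ℚ ≤ fromℕ a
0≤fromℕ zero    = ℚ.≤-refl
0≤fromℕ (suc a) = ℚ.+-mono-≤ 0≤1 (0≤fromℕ a)

fromℕ-mono : ∀ {a b} → a ℕ.≤ b → fromℕ a ≤ fromℕ b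
fromℕ-mono {a} {b} a≤b = begin
  fromℕ a                         ≡⟨ ℚ.+-identityʳ (fromℕ a) ⟨
  fromℕ a + 0ℚ                    ≤⟨ ℚ.+-monoʳ-≤ (fromℕ a) (0≤fromℕ (b ℕ.∸ a)) ⟩
  fromℕ a + fromℕ (b ℕ.∸ a)       ≡⟨ fromℕ-+ a (b ℕ.∸ a) ⟨
  fromℕ (a ℕ.+ (b ℕ.∸ a))         ≡⟨ cong fromℕ (ℕ.m+[n∸m]≡n a≤b) ⟩
  fromℕ b                         ∎
  where open ℚ.≤-Reasoning

two : ℚ
two = 1ℚ + 1ℚ

pow-+ : ∀ x a b → pow x (a ℕ.+ b) ≡ pow x a * pow x b
pow-+ x zero    b = sym (ℚ.*-identityˡ (pow x b))
pow-+ x (suc a) b = trans (cong (x *_) (pow-+ x a b)) (sym (ℚ.*-assoc x (pow x a) (pow x b)))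

fromℕ-2^ : ∀ k → fromℕ (2 ℕ.^ k) ≡ pow two k
fromℕ-2^ zero    = refl
fromℕ-2^ (suc k) = trans (fromℕ-* 2 (2 ℕ.^ k)) (cong (two *_) (fromℕ-2^ k))

0≤pow : ∀ {x} k → 0ℚ ≤ x → 0ℚ ≤ pow x k
0≤pow zero    0≤x = 0≤1
0≤pow (suc k) 0≤x = 0≤* 0≤x (0≤pow k 0≤x)

1≤pow-two : ∀ k → 1ℚ ≤ pow two k
1≤pow-two k = subst (1ℚ ≤_) (fromℕ-2^ k) (fromℕ-mono (ℕ.m^n>0 2 k))

sumSub : ∀ {m} → (Subset m → ℚ) → ℚ
sumSub {zero}  f = f []
sumSub {suc m} f = sumSub (f ∘ (false ∷_)) + sumSub (f ∘ (true ∷_))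

sumSubsets≡sumSub : ∀ {m} (f : Subset m → ℚ) → sumSubsets f ≡ sumSub f
sumSubsets≡sumSub {zero}  f = ℚ.+-identityʳ (f [])
sumSubsets≡sumSub {suc m} f = begin
  sumList (map f (map (false ∷_) L ++ map (true ∷_) L))
    ≡⟨ cong sumList (List.map-++ f (map (false ∷_) L) _) ⟩
  sumList (map f (map (false ∷_) L) ++ map f (map (true ∷_) L))
    ≡⟨ sumList-++ (map f (map (false ∷_) L)) _ ⟩
  sumList (map f (map (false ∷_) L)) + sumList (map f (map (true ∷_) L))
    ≡⟨ cong₂ _+_ (cong sumList (List.map-∘ L)) (cong sumList (List.map-∘ L)) ⟨
  sumSubsets (f ∘ (false ∷_)) + sumSubsets (f ∘ (true ∷_))
    ≡⟨ cong₂ _+_ (sumSubsets≡sumSub (f ∘ (false ∷_))) (sumSubsets≡sumSub (f ∘ (true ∷_))) ⟩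
  sumSub f ∎
  where
  open ≡-Reasoning
  L = allSubsets m
  sumList-++ : ∀ (xs ys : List ℚ) → sumList (xs ++ ys) ≡ sumList xs + sumList ys
  sumList-++ []       ys = sym (ℚ.+-identityˡ (sumList ys))
  sumList-++ (x ∷ xs) ys = trans (cong (x +_) (sumList-++ xs ys)) (sym (ℚ.+-assoc x (sumList xs) (sumList ys)))

sumSub-cong : ∀ {m} {f g : Subset m → ℚ} → (∀ S → f S ≡ g S) → sumSub f ≡ sumSub g
sumSub-cong {zero}  h = h []
sumSub-cong {suc m} h = cong₂ _+_ (sumSub-cong (h ∘ (false ∷_))) (sumSub-cong (h ∘ (true ∷_)))

sumSub-mono : ∀ {m} {f g : Subset m → ℚ} → (∀ S → f S ≤ g S) → sumSub f ≤ sumSub g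
sumSub-mono {zero}  h = h []
sumSub-mono {suc m} h = ℚ.+-mono-≤ (sumSub-mono (h ∘ (false ∷_))) (sumSub-mono (h ∘ (true ∷_)))

sumSub-+ : ∀ {m} (f g : Subset m → ℚ) → sumSub (λ S → f S + g S) ≡ sumSub f + sumSub g
sumSub-+ {zero}  f g = refl
sumSub-+ {suc m} f g =
  trans (cong₂ _+_ (sumSub-+ (f ∘ (false ∷_)) (g ∘ (false ∷_))) (sumSub-+ (f ∘ (true ∷_)) (g ∘ (true ∷_))))
        (solve 4 (λ a b c d → (a :+ b) :+ (c :+ d) := (a :+ c) :+ (b :+ d)) refl
                    (sumSub (f ∘ (false ∷_))) (sumSub (g ∘ (false ∷_)))
                    (sumSub (f ∘ (true ∷_))) (sumSub (g ∘ (true ∷_))))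

sumSub-*ˡ : ∀ {m} c (f : Subset m → ℚ) → sumSub (λ S → c * f S) ≡ c * sumSub f
sumSub-*ˡ {zero}  c f = refl
sumSub-*ˡ {suc m} c f =
  trans (cong₂ _+_ (sumSub-*ˡ c (f ∘ (false ∷_))) (sumSub-*ˡ c (f ∘ (true ∷_))))
        (sym (ℚ.*-distribˡ-+ c (sumSub (f ∘ (false ∷_))) _))

sumSub-comm : ∀ {a b} (f : Subset a → Subset b → ℚ) →
  sumSub (λ S → sumSub (f S)) ≡ sumSub (λ R → sumSub (λ S → f S R))
sumSub-comm {zero}  f = refl
sumSub-comm {suc a} f =
  trans (cong₂ _+_ (sumSub-comm (f ∘ (false ∷_))) (sumSub-comm (f ∘ (true ∷_))))
        (sym (sumSub-+ (λ R → sumSub (λ S → f (false ∷ S) R)) (λ R → sumSub (λ S → f (true ∷ S) R))))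

sumSub-fromℕ : ∀ {m} (f : Subset m → ℕ) → sumSub (fromℕ ∘ f) ≡ fromℕ (sumSubℕ f)
sumSub-fromℕ {zero}  f = refl
sumSub-fromℕ {suc m} f =
  trans (cong₂ _+_ (sumSub-fromℕ (f ∘ (false ∷_))) (sumSub-fromℕ (f ∘ (true ∷_))))
        (sym (fromℕ-+ (sumSubℕ (f ∘ (false ∷_))) _))

prodFin : ∀ {k} → (Fin k → ℚ) → ℚ
prodFin {zero}  f = 1ℚ
prodFin {suc k} f = f fz * prodFin (f ∘ fs)

prodFin-cong : ∀ {k} {f g : Fin k → ℚ} → (∀ i → f i ≡ g i) → prodFin f ≡ prodFin g
prodFin-cong {zero}  h = refl
prodFin-cong {suc k} h = cong₂ _*_ (h fz) (prodFin-cong (h ∘ fs))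

prodFin-1 : ∀ k → prodFin {k} (λ _ → 1ℚ) ≡ 1ℚ
prodFin-1 zero    = refl
prodFin-1 (suc k) = trans (ℚ.*-identityˡ _) (prodFin-1 k)

prodFin-* : ∀ {k} (f g : Fin k → ℚ) → prodFin f * prodFin g ≡ prodFin (λ i → f i * g i)
prodFin-* {zero}  f g = ℚ.*-identityˡ 1ℚ
prodFin-* {suc k} f g =
  trans (solve 4 (λ a b c d → (a :* b) :* (c :* d) := (a :* c) :* (b :* d)) refl
                    (f fz) (prodFin (f ∘ fs)) (g fz) (prodFin (g ∘ fs)))
        (cong (f fz * g fz *_) (prodFin-* (f ∘ fs) (g ∘ fs)))

0≤prodFin : ∀ {k} (f : Fin k → ℚ) → (∀ i → 0ℚ ≤ f i) → 0ℚ ≤ prodFin f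
0≤prodFin {zero}  f h = 0≤1
0≤prodFin {suc k} f h = 0≤* (h fz) (0≤prodFin (f ∘ fs) (h ∘ fs))

sumSub-prodFin : ∀ {m} (F : Fin m → Bool → ℚ) →
  sumSub (λ R → prodFin (λ e → F e (lookup R e))) ≡ prodFin (λ e → F e false + F e true)
sumSub-prodFin {zero}  F = refl
sumSub-prodFin {suc m} F = begin
  sumSub (λ R → F fz false * P R) + sumSub (λ R → F fz true * P R)
    ≡⟨ cong₂ _+_ (sumSub-*ˡ (F fz false) P) (sumSub-*ˡ (F fz true) P) ⟩
  F fz false * sumSub P + F fz true * sumSub P
    ≡⟨ ℚ.*-distribʳ-+ (sumSub P) (F fz false) (F fz true) ⟨
  (F fz false + F fz true) * sumSub P
    ≡⟨ cong ((F fz false + F fz true) *_) (sumSub-prodFin (F ∘ fs)) ⟩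
  prodFin (λ e → F e false + F e true) ∎
  where
  open ≡-Reasoning
  P : Subset m → ℚ
  P R = prodFin (λ e → F (fs e) (lookup R e))

/'≡1/'* : ∀ x y → x /' y ≡ (1ℚ /' y) * x
/'≡1/'* x y with y ℚ.≟ 0ℚ
... | yes _   = sym (ℚ.*-zeroˡ x)
... | no  y≢0 = trans (ℚ.*-comm x _) (cong (_* x) (sym (ℚ.*-identityˡ ((1/ y) {{≢-nonZero y≢0}}))))

/'-cancelʳ : ∀ x y → (0<y : 0ℚ < y) → (x /' y) * y ≡ x
/'-cancelʳ x y 0<y with y ℚ.≟ 0ℚ
... | yes refl = ⊥-elim (ℚ.<-irrefl refl 0<y)
... | no  y≢0  = begin
  x * 1/y * y   ≡⟨ ℚ.*-assoc x 1/y y ⟩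
  x * (1/y * y) ≡⟨ cong (x *_) (ℚ.*-inverseˡ y {{≢-nonZero y≢0}}) ⟩
  x * 1ℚ        ≡⟨ ℚ.*-identityʳ x ⟩
  x             ∎
  where
  open ≡-Reasoning
  1/y = (1/ y) {{≢-nonZero y≢0}}

/'-≤ : ∀ {x z F G} → 0ℚ < F → 0ℚ < G → x * G ≤ z * F → x /' F ≤ z /' G
/'-≤ {x} {z} {F} {G} 0<F 0<G xG≤zF =
  ℚ.*-cancelʳ-≤-pos (F * G) {{ℚ.pos*pos⇒pos F {{positive 0<F}} G {{positive 0<G}}}} (begin
    (x /' F) * (F * G) ≡⟨ ℚ.*-assoc (x /' F) F G ⟨
    (x /' F) * F * G   ≡⟨ cong (_* G) (/'-cancelʳ x F 0<F) ⟩
    x * G              ≤⟨ xG≤zF ⟩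
    z * F              ≡⟨ cong (_* F) (/'-cancelʳ z G 0<G) ⟨
    (z /' G) * G * F   ≡⟨ solve 3 (λ a g f → a :* g :* f := a :* (f :* g)) refl (z /' G) G F ⟩
    (z /' G) * (F * G) ∎)
  where open ℚ.≤-Reasoning

-- for N = 0 this holds because of the junk value 1 /' 0 = 0
1/'*≤½* : ∀ {N x y} → 0ℚ ≤ N → 0ℚ ≤ y → two * x ≤ N * y → (1ℚ /' N) * x ≤ ½ * y
1/'*≤½* {N} {x} {y} 0≤N 0≤y 2x≤Ny with N ℚ.≟ 0ℚ
... | yes _   = subst (_≤ ½ * y) (sym (ℚ.*-zeroˡ x)) (0≤* (ℚ.<⇒≤ (ℚ.positive⁻¹ ½)) 0≤y)
... | no  N≢0 = begin
  1ℚ * 1/N * x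
    ≡⟨ solve 2 (λ i x → con 1ℚ :* i :* x := i :* (con ½ :* ((con 1ℚ :+ con 1ℚ) :* x))) refl 1/N x ⟩
  1/N * (½ * (two * x))
    ≤⟨ *-monoˡ-≤-0≤ 0≤1/N (*-monoˡ-≤-0≤ (ℚ.<⇒≤ (ℚ.positive⁻¹ ½)) 2x≤Ny) ⟩
  1/N * (½ * (N * y))
    ≡⟨ solve 4 (λ i h n y → i :* (h :* (n :* y)) := h :* y :* (n :* i)) refl 1/N ½ N y ⟩
  ½ * y * (N * 1/N)
    ≡⟨ cong (½ * y *_) (ℚ.*-inverseʳ N {{≢-nonZero N≢0}}) ⟩
  ½ * y * 1ℚ
    ≡⟨ ℚ.*-identityʳ (½ * y) ⟩
  ½ * y ∎
  where
  open ℚ.≤-Reasoning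
  1/N = (1/ N) {{≢-nonZero N≢0}}
  N>0 = ℚ.nonNeg∧nonZero⇒pos N {{nonNegative 0≤N}} {{≢-nonZero N≢0}}
  0≤1/N : 0ℚ ≤ 1/N
  0≤1/N = ℚ.<⇒≤ (ℚ.positive⁻¹ 1/N {{ℚ.1/pos⇒pos N {{N>0}}}})

normalise-≤ : ∀ {m} (f g : Subset m → ℚ) {t c : ℚ} → 0ℚ ≤ t → (∀ R → 0ℚ ≤ f R) →
  (∀ R → g R ≤ t * f R) → (∀ R → t * f R ≤ c * g R) → 0ℚ < sumSub g →
  ∀ R → f R /' sumSub f ≤ c * (g R /' sumSub g)
normalise-≤ f g {t} {c} 0≤t 0≤f g≤tf tf≤cg 0<G R = begin
  f R /' F
    ≤⟨ /'-≤ 0<F 0<G fG≤cgF ⟩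
  (c * g R) /' G
    ≡⟨ /'≡1/'* (c * g R) G ⟩
  (1ℚ /' G) * (c * g R)
    ≡⟨ solve 3 (λ i c x → i :* (c :* x) := c :* (i :* x)) refl (1ℚ /' G) c (g R) ⟩
  c * ((1ℚ /' G) * g R)
    ≡⟨ cong (c *_) (/'≡1/'* (g R) G) ⟨
  c * (g R /' G) ∎
  where
  open ℚ.≤-Reasoning
  F = sumSub f
  G = sumSub g
  G≤tF : G ≤ t * F
  G≤tF = ℚ.≤-trans (sumSub-mono g≤tf) (ℚ.≤-reflexive (sumSub-*ˡ t f))
  0<F : 0ℚ < F
  0<F = ℚ.≰⇒> λ F≤0 → ℚ.<-irrefl refl (ℚ.<-≤-trans 0<G (ℚ.≤-trans G≤tF
          (subst (t * F ≤_) (ℚ.*-zeroʳ t) (*-monoˡ-≤-0≤ 0≤t F≤0))))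
  fG≤cgF : f R * G ≤ c * g R * F
  fG≤cgF = begin
    f R * G       ≤⟨ *-monoˡ-≤-0≤ (0≤f R) G≤tF ⟩
    f R * (t * F) ≡⟨ solve 3 (λ x t F → x :* (t :* F) := t :* x :* F) refl (f R) t F ⟩
    t * f R * F   ≤⟨ *-monoʳ-≤-0≤ (ℚ.<⇒≤ 0<F) (tf≤cg R) ⟩
    c * g R * F   ∎

-- The measures as products over edges

bernoulli≡prodFin : ∀ {n m} (ends : Ends n m) r R →
  pow r (size ends R) * pow (1ℚ - r) (m ℕ.∸ size ends R) ≡ prodFin (λ e → if lookup R e then r else 1ℚ - r)
bernoulli≡prodFin ends r []          = ℚ.*-identityˡ 1ℚ
bernoulli≡prodFin ends r (true ∷ R)  =
  trans (ℚ.*-assoc r _ _) (cong (r *_) (bernoulli≡prodFin (ends ∘ fs) r R))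
bernoulli≡prodFin {m = suc m} ends r (false ∷ R) = begin
  pow r s * pow (1ℚ - r) (suc m ℕ.∸ s)
    ≡⟨ cong (λ k → pow r s * pow (1ℚ - r) k) (ℕ.+-∸-assoc 1 (countFin-≤ (lookup R))) ⟩
  pow r s * ((1ℚ - r) * pow (1ℚ - r) (m ℕ.∸ s))
    ≡⟨ solve 3 (λ a b c → a :* (b :* c) := b :* (a :* c)) refl (pow r s) (1ℚ - r) _ ⟩
  (1ℚ - r) * (pow r s * pow (1ℚ - r) (m ℕ.∸ s))
    ≡⟨ cong ((1ℚ - r) *_) (bernoulli≡prodFin (ends ∘ fs) r R) ⟩
  prodFin (λ e → if lookup (false ∷ R) e then r else 1ℚ - r) ∎
  where
  open ≡-Reasoning
  s = size (ends ∘ fs) R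

edgeTransition : ℚ → Bool → Bool → ℚ
edgeTransition q true  true  = 1ℚ
edgeTransition q true  false = 0ℚ
edgeTransition q false true  = q
edgeTransition q false false = 1ℚ - q

transition≡prodFin : ∀ {n m} (ends : Ends n m) p S R →
  transition ends p S R ≡ prodFin (λ e → edgeTransition (q ends p) (lookup S e) (lookup R e))
transition≡prodFin ends p []          []          = refl
transition≡prodFin ends p (true ∷ S)  (true ∷ R)  = cong (1ℚ *_) (transition≡prodFin (ends ∘ fs) p S R)
transition≡prodFin ends p (true ∷ S)  (false ∷ R) = cong (0ℚ *_) (transition≡prodFin (ends ∘ fs) p S R)
transition≡prodFin ends p (false ∷ S) (true ∷ R)  = cong (q ends p *_) (transition≡prodFin (ends ∘ fs) p S R)
transition≡prodFin ends p (false ∷ S) (false ∷ R) =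
  cong ((1ℚ - q ends p) *_) (transition≡prodFin (ends ∘ fs) p S R)

𝟙 : Bool → ℚ
𝟙 b = fromℕ (ind b)

𝟙-∧ : ∀ a b → 𝟙 a * 𝟙 b ≡ 𝟙 (a ∧ b)
𝟙-∧ true  b = ℚ.*-identityˡ (𝟙 b)
𝟙-∧ false b = ℚ.*-zeroˡ (𝟙 b)

sumSub-transition : ∀ {n m} (ends : Ends n m) p S → sumSub (transition ends p S) ≡ 1ℚ
sumSub-transition {m = m} ends p S = begin
  sumSub (transition ends p S)
    ≡⟨ sumSub-cong (transition≡prodFin ends p S) ⟩
  sumSub (λ R → prodFin (λ e → edgeTransition (q ends p) (lookup S e) (lookup R e)))
    ≡⟨ sumSub-prodFin (λ e → edgeTransition (q ends p) (lookup S e)) ⟩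
  prodFin (λ e → edgeTransition (q ends p) (lookup S e) false + edgeTransition (q ends p) (lookup S e) true)
    ≡⟨ prodFin-cong (λ e → total (lookup S e)) ⟩
  prodFin {m} (λ _ → 1ℚ)
    ≡⟨ prodFin-1 m ⟩
  1ℚ ∎
  where
  open ≡-Reasoning
  total : ∀ s → edgeTransition (q ends p) s false + edgeTransition (q ends p) s true ≡ 1ℚ
  total true  = ℚ.+-identityˡ 1ℚ
  total false = solve 1 (λ x → (con 1ℚ :- x) :+ x := con 1ℚ) refl (q ends p)

⊆ᵇ-prodFin : ∀ {k} (S R : Subset k) (D : Bool → ℚ) →
  prodFin (λ e → 𝟙 (not (lookup S e) ∨ lookup R e) * D (lookup R e)) ≡ 𝟙 (S ⊆ᵇ R) * prodFin (D ∘ lookup R)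
⊆ᵇ-prodFin []      []      D = sym (ℚ.*-identityˡ 1ℚ)
⊆ᵇ-prodFin (s ∷ S) (r ∷ R) D = begin
  𝟙 (not s ∨ r) * D r * prodFin (λ e → 𝟙 (not (lookup S e) ∨ lookup R e) * D (lookup R e))
    ≡⟨ cong (𝟙 (not s ∨ r) * D r *_) (⊆ᵇ-prodFin S R D) ⟩
  𝟙 (not s ∨ r) * D r * (𝟙 (S ⊆ᵇ R) * prodFin (D ∘ lookup R))
    ≡⟨ solve 4 (λ a b c d → (a :* b) :* (c :* d) := (a :* c) :* (b :* d)) refl
                  (𝟙 (not s ∨ r)) (D r) (𝟙 (S ⊆ᵇ R)) (prodFin (D ∘ lookup R)) ⟩
  𝟙 (not s ∨ r) * 𝟙 (S ⊆ᵇ R) * (D r * prodFin (D ∘ lookup R))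
    ≡⟨ cong (_* (D r * prodFin (D ∘ lookup R))) (𝟙-∧ (not s ∨ r) (S ⊆ᵇ R)) ⟩
  𝟙 ((s ∷ S) ⊆ᵇ (r ∷ R)) * prodFin (D ∘ lookup (r ∷ R)) ∎
  where open ≡-Reasoning

_⁻² : ℕ → ℚ
n ⁻² = 1ℚ /' fromℕ (n ℕ.* n)

#even*2ⁿ : ∀ {n m} (ends : Ends n m) R →
  fromℕ (#even ends R) * pow two n ≡ pow two (size ends R ℕ.+ κ ends R)
#even*2ⁿ {n} ends R = begin
  fromℕ (#even ends R) * pow two n          ≡⟨ cong (fromℕ (#even ends R) *_) (fromℕ-2^ n) ⟨
  fromℕ (#even ends R) * fromℕ (2 ℕ.^ n)    ≡⟨ fromℕ-* (#even ends R) (2 ℕ.^ n) ⟨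
  fromℕ (#even ends R ℕ.* 2 ℕ.^ n)          ≡⟨ cong fromℕ (#even-cycleSpace ends R) ⟩
  fromℕ (2 ℕ.^ (size ends R ℕ.+ κ ends R))  ≡⟨ fromℕ-2^ (size ends R ℕ.+ κ ends R) ⟩
  pow two (size ends R ℕ.+ κ ends R)        ∎
  where open ≡-Reasoning

0≤⁻² : ∀ n → 0ℚ ≤ n ⁻²
0≤⁻² n with fromℕ (n ℕ.* n) ℚ.≟ 0ℚ
... | yes _   = ℚ.≤-refl
... | no  N≢0 = 0≤* 0≤1 (ℚ.<⇒≤ (ℚ.positive⁻¹ ((1/ N) {{≢-nonZero N≢0}}) {{ℚ.1/pos⇒pos N {{N>0}}}}))
  where
  N = fromℕ (n ℕ.* n)
  N>0 = ℚ.nonNeg∧nonZero⇒pos N {{nonNegative (0≤fromℕ (n ℕ.* n))}} {{≢-nonZero N≢0}}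

⁻²*#twoOdd≤ : ∀ {n m} (ends : Ends n m) R →
  n ⁻² * fromℕ (#twoOdd ends R) ≤ ½ * fromℕ (#even ends R)
⁻²*#twoOdd≤ {n} ends R = 1/'*≤½* (0≤fromℕ (n ℕ.* n)) (0≤fromℕ (#even ends R)) (begin
  two * fromℕ (#twoOdd ends R)              ≡⟨ fromℕ-* 2 (#twoOdd ends R) ⟨
  fromℕ (2 ℕ.* #twoOdd ends R)              ≤⟨ fromℕ-mono (#twoOdd-bound ends R) ⟩
  fromℕ (n ℕ.* (n ℕ.* #even ends R))        ≡⟨ cong fromℕ (ℕ.*-assoc n n (#even ends R)) ⟨
  fromℕ (n ℕ.* n ℕ.* #even ends R)          ≡⟨ fromℕ-* (n ℕ.* n) (#even ends R) ⟩
  fromℕ (n ℕ.* n) * fromℕ (#even ends R)    ∎)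
  where open ℚ.≤-Reasoning

module Worm {n m} (ends : Ends n m) (p : ℚ) (0≤p : 0ℚ ≤ p) (p≤½ : p ≤ ½) where

  base : Subset m → ℚ
  base R = prodFin (λ e → if lookup R e then p else 1ℚ - (p + p))

  0≤1-2p : 0ℚ ≤ 1ℚ - (p + p)
  0≤1-2p = ℚ.+-monoʳ-≤ 1ℚ (ℚ.neg-antimono-≤ (ℚ.+-mono-≤ p≤½ p≤½))

  0≤base : ∀ R → 0ℚ ≤ base R
  0≤base R = 0≤prodFin _ λ e → edge (lookup R e)
    where
    edge : ∀ r → 0ℚ ≤ (if r then p else 1ℚ - (p + p))
    edge true  = 0≤p
    edge false = 0≤1-2p

  0<1-p : 0ℚ < 1ℚ - p
  0<1-p = ℚ.<-≤-trans (ℚ.positive⁻¹ ½) (ℚ.+-monoʳ-≤ 1ℚ (ℚ.neg-antimono-≤ p≤½))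

  1-p*q≡p : (1ℚ - p) * q ends p ≡ p
  1-p*q≡p = trans (ℚ.*-comm (1ℚ - p) (q ends p)) (/'-cancelʳ p (1ℚ - p) 0<1-p)

  -- the identity (1 - p)(1 - q) = 1 - 2p is where the parameter 2p of the random cluster measure comes from
  edge-weight : ∀ s r → (if s then p else 1ℚ - p) * edgeTransition (q ends p) s r ≡
                        𝟙 (not s ∨ r) * (if r then p else 1ℚ - (p + p))
  edge-weight true  true  = trans (ℚ.*-identityʳ p) (sym (ℚ.*-identityˡ p))
  edge-weight true  false = trans (ℚ.*-zeroʳ p) (sym (ℚ.*-zeroˡ (1ℚ - (p + p))))
  edge-weight false true  = trans 1-p*q≡p (sym (ℚ.*-identityˡ p))
  edge-weight false false = begin
    (1ℚ - p) * (1ℚ - q ends p)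
      ≡⟨ solve 2 (λ y x → y :* (con 1ℚ :- x) := y :- y :* x) refl (1ℚ - p) (q ends p) ⟩
    (1ℚ - p) - (1ℚ - p) * q ends p
      ≡⟨ cong ((1ℚ - p) -_) 1-p*q≡p ⟩
    (1ℚ - p) - p
      ≡⟨ solve 1 (λ x → (con 1ℚ :- x) :- x := con 1ℚ :* (con 1ℚ :- (x :+ x))) refl p ⟩
    1ℚ * (1ℚ - (p + p)) ∎
    where open ≡-Reasoning

  wp*transition : ∀ S R → wp ends p S * transition ends p S R ≡ 𝟙 (S ⊆ᵇ R) * base R
  wp*transition S R = begin
    wp ends p S * transition ends p S R
      ≡⟨ cong₂ _*_ (bernoulli≡prodFin ends p S) (transition≡prodFin ends p S R) ⟩
    prodFin keep * prodFin step
      ≡⟨ prodFin-* keep step ⟩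
    prodFin (λ e → keep e * step e)
      ≡⟨ prodFin-cong (λ e → edge-weight (lookup S e) (lookup R e)) ⟩
    prodFin (λ e → 𝟙 (not (lookup S e) ∨ lookup R e) * (if lookup R e then p else 1ℚ - (p + p)))
      ≡⟨ ⊆ᵇ-prodFin S R (λ r → if r then p else 1ℚ - (p + p)) ⟩
    𝟙 (S ⊆ᵇ R) * base R ∎
    where
    open ≡-Reasoning
    keep step : Fin m → ℚ
    keep e = if lookup S e then p else 1ℚ - p
    step e = edgeTransition (q ends p) (lookup S e) (lookup R e)

  oddWeight : Subset m → ℚ
  oddWeight S = 𝟙 (oddCount ends S ≡ᵇ 0) + n ⁻² * 𝟙 (oddCount ends S ≡ᵇ 2)

  wWorm≡ : ∀ S → wWorm ends p S ≡ oddWeight S * wp ends p S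
  wWorm≡ S with oddCount ends S
  ... | 0                 = solve 2 (λ i w → w := (con 1ℚ :+ i :* con 0ℚ) :* w) refl (n ⁻²) (wp ends p S)
  ... | 1                 = solve 2 (λ i w → con 0ℚ := (con 0ℚ :+ i :* con 0ℚ) :* w) refl (n ⁻²) (wp ends p S)
  ... | 2                 = trans (/'≡1/'* (wp ends p S) (fromℕ (n ℕ.* n)))
                                  (solve 2 (λ i w → i :* w := (con 0ℚ :+ i :* con 1ℚ) :* w) refl (n ⁻²) (wp ends p S))
  ... | suc (suc (suc _)) = solve 2 (λ i w → con 0ℚ := (con 0ℚ :+ i :* con 0ℚ) :* w) refl (n ⁻²) (wp ends p S)

  -- π̂ before normalisation
  mass : Subset m → ℚ
  mass R = sumSub (λ S → wWorm ends p S * transition ends p S R)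

  𝟙⊆ᵇ*oddWeight : ∀ R S → 𝟙 (S ⊆ᵇ R) * oddWeight S ≡
    𝟙 (S ⊆ᵇ R ∧ ((λ _ → false) ≐ ∂ ends S)) + n ⁻² * 𝟙 (S ⊆ᵇ R ∧ (countFin (∂ ends S) ≡ᵇ 2))
  𝟙⊆ᵇ*oddWeight R S = begin
    𝟙 b * (𝟙 (k ≡ᵇ 0) + n ⁻² * 𝟙 (k ≡ᵇ 2))
      ≡⟨ solve 4 (λ b x i y → b :* (x :+ i :* y) := b :* x :+ i :* (b :* y)) refl
                 (𝟙 b) (𝟙 (k ≡ᵇ 0)) (n ⁻²) (𝟙 (k ≡ᵇ 2)) ⟩
    𝟙 b * 𝟙 (k ≡ᵇ 0) + n ⁻² * (𝟙 b * 𝟙 (k ≡ᵇ 2))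
      ≡⟨ cong₂ (λ x y → x + n ⁻² * y) (𝟙-∧ b (k ≡ᵇ 0)) (𝟙-∧ b (k ≡ᵇ 2)) ⟩
    𝟙 (b ∧ (k ≡ᵇ 0)) + n ⁻² * 𝟙 (b ∧ (k ≡ᵇ 2))
      ≡⟨ cong₂ (λ x y → 𝟙 (b ∧ x) + n ⁻² * 𝟙 (b ∧ (y ≡ᵇ 2)))
               (trans (cong (_≡ᵇ 0) (oddCount≡∣∂∣ ends S)) (countFin≡ᵇ0 (∂ ends S))) (oddCount≡∣∂∣ ends S) ⟩
    𝟙 (b ∧ ((λ _ → false) ≐ ∂ ends S)) + n ⁻² * 𝟙 (b ∧ (countFin (∂ ends S) ≡ᵇ 2)) ∎
    where
    open ≡-Reasoning
    b = S ⊆ᵇ R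
    k = oddCount ends S

  mass≡ : ∀ R → mass R ≡ base R * (fromℕ (#even ends R) + n ⁻² * fromℕ (#twoOdd ends R))
  mass≡ R = begin
    sumSub (λ S → wWorm ends p S * transition ends p S R)
      ≡⟨ sumSub-cong pointwise ⟩
    sumSub (λ S → base R * (𝟙 (S ⊆ᵇ R) * oddWeight S))
      ≡⟨ sumSub-*ˡ (base R) (λ S → 𝟙 (S ⊆ᵇ R) * oddWeight S) ⟩
    base R * sumSub (λ S → 𝟙 (S ⊆ᵇ R) * oddWeight S)
      ≡⟨ cong (base R *_) (sumSub-cong (𝟙⊆ᵇ*oddWeight R)) ⟩
    base R * sumSub (λ S → 𝟙 (even S) + n ⁻² * 𝟙 (twoOdd S))
      ≡⟨ cong (base R *_) (sumSub-+ (𝟙 ∘ even) (λ S → n ⁻² * 𝟙 (twoOdd S))) ⟩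
    base R * (sumSub (𝟙 ∘ even) + sumSub (λ S → n ⁻² * 𝟙 (twoOdd S)))
      ≡⟨ cong (λ x → base R * (sumSub (𝟙 ∘ even) + x)) (sumSub-*ˡ (n ⁻²) (𝟙 ∘ twoOdd)) ⟩
    base R * (sumSub (𝟙 ∘ even) + n ⁻² * sumSub (𝟙 ∘ twoOdd))
      ≡⟨ cong₂ (λ x y → base R * (x + n ⁻² * y)) (sumSub-fromℕ (ind ∘ even)) (sumSub-fromℕ (ind ∘ twoOdd)) ⟩
    base R * (fromℕ (#even ends R) + n ⁻² * fromℕ (#twoOdd ends R)) ∎
    where
    open ≡-Reasoning
    even twoOdd : Subset m → Bool
    even   S = S ⊆ᵇ R ∧ ((λ _ → false) ≐ ∂ ends S)
    twoOdd S = S ⊆ᵇ R ∧ (countFin (∂ ends S) ≡ᵇ 2)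
    pointwise : ∀ S → wWorm ends p S * transition ends p S R ≡ base R * (𝟙 (S ⊆ᵇ R) * oddWeight S)
    pointwise S = begin
      wWorm ends p S * transition ends p S R
        ≡⟨ cong (_* transition ends p S R) (wWorm≡ S) ⟩
      oddWeight S * wp ends p S * transition ends p S R
        ≡⟨ ℚ.*-assoc (oddWeight S) _ _ ⟩
      oddWeight S * (wp ends p S * transition ends p S R)
        ≡⟨ cong (oddWeight S *_) (wp*transition S R) ⟩
      oddWeight S * (𝟙 (S ⊆ᵇ R) * base R)
        ≡⟨ solve 3 (λ w b B → w :* (b :* B) := B :* (b :* w)) refl (oddWeight S) (𝟙 (S ⊆ᵇ R)) (base R) ⟩
      base R * (𝟙 (S ⊆ᵇ R) * oddWeight S) ∎

  sumSub-mass : sumSub mass ≡ sumSubsets (wWorm ends p)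
  sumSub-mass = begin
    sumSub (λ R → sumSub (λ S → wWorm ends p S * transition ends p S R))
      ≡⟨ sumSub-comm (λ S R → wWorm ends p S * transition ends p S R) ⟨
    sumSub (λ S → sumSub (λ R → wWorm ends p S * transition ends p S R))
      ≡⟨ sumSub-cong (λ S → sumSub-*ˡ (wWorm ends p S) (transition ends p S)) ⟩
    sumSub (λ S → wWorm ends p S * sumSub (transition ends p S))
      ≡⟨ sumSub-cong (λ S → trans (cong (wWorm ends p S *_) (sumSub-transition ends p S)) (ℚ.*-identityʳ _)) ⟩
    sumSub (wWorm ends p)
      ≡⟨ sumSubsets≡sumSub (wWorm ends p) ⟨
    sumSubsets (wWorm ends p) ∎
    where open ≡-Reasoning

  πHat≡ : ∀ R → πHat ends p R ≡ mass R /' sumSub mass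
  πHat≡ R = begin
    sumSubsets (λ S → πWorm ends p S * transition ends p S R)
      ≡⟨ sumSubsets≡sumSub (λ S → πWorm ends p S * transition ends p S R) ⟩
    sumSub (λ S → (wWorm ends p S /' Z) * transition ends p S R)
      ≡⟨ sumSub-cong (λ S → trans (cong (_* transition ends p S R) (/'≡1/'* (wWorm ends p S) Z))
                                  (ℚ.*-assoc (1ℚ /' Z) _ _)) ⟩
    sumSub (λ S → (1ℚ /' Z) * (wWorm ends p S * transition ends p S R))
      ≡⟨ sumSub-*ˡ (1ℚ /' Z) (λ S → wWorm ends p S * transition ends p S R) ⟩
    (1ℚ /' Z) * mass R
      ≡⟨ /'≡1/'* (mass R) Z ⟨
    mass R /' Z
      ≡⟨ cong (mass R /'_) sumSub-mass ⟨
    mass R /' sumSub mass ∎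
    where
    open ≡-Reasoning
    Z = sumSubsets (wWorm ends p)

  W : Subset m → ℚ
  W = wRC ends (p + p) two

  doubled≡base*pow : ∀ {k} (R : Subset k) →
    prodFin (λ e → if lookup R e then p + p else 1ℚ - (p + p)) ≡
    prodFin (λ e → if lookup R e then p else 1ℚ - (p + p)) * pow two (countFin (lookup R))
  doubled≡base*pow []          = sym (ℚ.*-identityˡ 1ℚ)
  doubled≡base*pow (true ∷ R)  =
    trans (cong ((p + p) *_) (doubled≡base*pow R))
          (solve 3 (λ p b t → (p :+ p) :* (b :* t) := (p :* b) :* ((con 1ℚ :+ con 1ℚ) :* t)) refl
                      p (prodFin (λ e → if lookup R e then p else 1ℚ - (p + p))) (pow two (countFin (lookup R))))
  doubled≡base*pow (false ∷ R) =
    trans (cong ((1ℚ - (p + p)) *_) (doubled≡base*pow R)) (sym (ℚ.*-assoc (1ℚ - (p + p)) _ _))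

  W≡ : ∀ R → W R ≡ base R * pow two (size ends R ℕ.+ κ ends R)
  W≡ R = begin
    pow (p + p) (size ends R) * pow (1ℚ - (p + p)) (m ℕ.∸ size ends R) * pow two (κ ends R)
      ≡⟨ cong (_* pow two (κ ends R)) (trans (bernoulli≡prodFin ends (p + p) R) (doubled≡base*pow R)) ⟩
    base R * pow two (size ends R) * pow two (κ ends R)
      ≡⟨ ℚ.*-assoc (base R) _ _ ⟩
    base R * (pow two (size ends R) * pow two (κ ends R))
      ≡⟨ cong (base R *_) (pow-+ two (size ends R) (κ ends R)) ⟨
    base R * pow two (size ends R ℕ.+ κ ends R) ∎
    where open ≡-Reasoning

  0≤mass : ∀ R → 0ℚ ≤ mass R
  0≤mass R = subst (0ℚ ≤_) (sym (mass≡ R))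
    (0≤* (0≤base R) (ℚ.+-mono-≤ (0≤fromℕ (#even ends R)) (0≤* (0≤⁻² n) (0≤fromℕ (#twoOdd ends R)))))

  -- the worm's Ω₂ part, rescaled by 2ⁿ
  excess : Subset m → ℚ
  excess R = base R * (pow two n * (n ⁻² * fromℕ (#twoOdd ends R)))

  2ⁿ*mass≡ : ∀ R → pow two n * mass R ≡ W R + excess R
  2ⁿ*mass≡ R = begin
    pow two n * mass R
      ≡⟨ cong (pow two n *_) (mass≡ R) ⟩
    pow two n * (base R * (fromℕ (#even ends R) + n ⁻² * fromℕ (#twoOdd ends R)))
      ≡⟨ solve 5 (λ t b e i f → t :* (b :* (e :+ i :* f)) := b :* (e :* t) :+ b :* (t :* (i :* f))) refl
                    (pow two n) (base R) (fromℕ (#even ends R)) (n ⁻²) (fromℕ (#twoOdd ends R)) ⟩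
    base R * (fromℕ (#even ends R) * pow two n) + excess R
      ≡⟨ cong (λ x → base R * x + excess R) (#even*2ⁿ ends R) ⟩
    base R * pow two (size ends R ℕ.+ κ ends R) + excess R
      ≡⟨ cong (_+ excess R) (W≡ R) ⟨
    W R + excess R ∎
    where open ≡-Reasoning

  0≤2ⁿ : 0ℚ ≤ pow two n
  0≤2ⁿ = 0≤pow n (ℚ.+-mono-≤ 0≤1 0≤1)

  excess≤½W : ∀ R → excess R ≤ ½ * W R
  excess≤½W R = begin
    base R * (pow two n * (n ⁻² * fromℕ (#twoOdd ends R)))
      ≤⟨ *-monoˡ-≤-0≤ (0≤base R) (*-monoˡ-≤-0≤ 0≤2ⁿ (⁻²*#twoOdd≤ ends R)) ⟩
    base R * (pow two n * (½ * fromℕ (#even ends R)))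
      ≡⟨ solve 4 (λ b t h e → b :* (t :* (h :* e)) := h :* (b :* (e :* t))) refl
                    (base R) (pow two n) ½ (fromℕ (#even ends R)) ⟩
    ½ * (base R * (fromℕ (#even ends R) * pow two n))
      ≡⟨ cong (λ x → ½ * (base R * x)) (#even*2ⁿ ends R) ⟩
    ½ * (base R * pow two (size ends R ℕ.+ κ ends R))
      ≡⟨ cong (½ *_) (W≡ R) ⟨
    ½ * W R ∎
    where open ℚ.≤-Reasoning

  W≤2ⁿ*mass : ∀ R → W R ≤ pow two n * mass R
  W≤2ⁿ*mass R = begin
    W R
      ≡⟨ ℚ.+-identityʳ (W R) ⟨
    W R + 0ℚ
      ≤⟨ ℚ.+-monoʳ-≤ (W R) (0≤* (0≤base R) (0≤* 0≤2ⁿ (0≤* (0≤⁻² n) (0≤fromℕ (#twoOdd ends R))))) ⟩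
    W R + excess R
      ≡⟨ 2ⁿ*mass≡ R ⟨
    pow two n * mass R ∎
    where open ℚ.≤-Reasoning

  2ⁿ*mass≤W : ∀ R → pow two n * mass R ≤ (1ℚ + ½) * W R
  2ⁿ*mass≤W R = begin
    pow two n * mass R ≡⟨ 2ⁿ*mass≡ R ⟩
    W R + excess R     ≤⟨ ℚ.+-monoʳ-≤ (W R) (excess≤½W R) ⟩
    W R + ½ * W R      ≡⟨ solve 2 (λ w h → w :+ h :* w := (con 1ℚ :+ h) :* w) refl (W R) ½ ⟩
    (1ℚ + ½) * W R     ∎
    where open ℚ.≤-Reasoning

  0<sumSub-W : 0ℚ < sumSub W
  0<sumSub-W = ℚ.<-≤-trans (ℚ.positive⁻¹ 1ℚ) (begin
    1ℚ
      ≡⟨ prodFin-1 m ⟨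
    prodFin {m} (λ _ → 1ℚ)
      ≡⟨ prodFin-cong {m} (λ _ → solve 1 (λ x → con 1ℚ := (con 1ℚ :- x) :+ x) refl (p + p)) ⟩
    prodFin {m} (λ _ → (1ℚ - (p + p)) + (p + p))
      ≡⟨ sumSub-prodFin {m} (λ _ r → if r then p + p else 1ℚ - (p + p)) ⟨
    sumSub {m} (λ R → prodFin (λ e → if lookup R e then p + p else 1ℚ - (p + p)))
      ≤⟨ sumSub-mono bernoulli≤W ⟩
    sumSub W ∎)
    where
    open ℚ.≤-Reasoning
    bernoulli≤W : ∀ R → prodFin (λ e → if lookup R e then p + p else 1ℚ - (p + p)) ≤ W R
    bernoulli≤W R = begin
      B
        ≡⟨ ℚ.*-identityʳ B ⟨
      B * 1ℚ
        ≤⟨ *-monoˡ-≤-0≤ (0≤prodFin _ (λ e → edge (lookup R e))) (1≤pow-two (κ ends R)) ⟩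
      B * pow two (κ ends R)
        ≡⟨ cong (_* pow two (κ ends R)) (bernoulli≡prodFin ends (p + p) R) ⟨
      W R ∎
      where
      B = prodFin (λ e → if lookup R e then p + p else 1ℚ - (p + p))
      edge : ∀ r → 0ℚ ≤ (if r then p + p else 1ℚ - (p + p))
      edge true  = ℚ.+-mono-≤ 0≤p 0≤p
      edge false = 0≤1-2p

  πRC≡ : ∀ R → πRC ends (p + p) two R ≡ W R /' sumSub W
  πRC≡ R = cong (W R /'_) (sumSubsets≡sumSub W)

lemma3p3 : (n m : ℕ) (ends : Ends n m) (p : ℚ) →
    0ℚ < p → p ≤ ½ →
    (R : Subset m) →
    πHat ends p R ≤ (1ℚ + ½) * πRC ends (p + p) (1ℚ + 1ℚ) R
lemma3p3 n m ends p 0<p p≤½ R = begin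
  πHat ends p R
    ≡⟨ πHat≡ R ⟩
  mass R /' sumSub mass
    ≤⟨ normalise-≤ mass W {c = 1ℚ + ½} 0≤2ⁿ 0≤mass W≤2ⁿ*mass 2ⁿ*mass≤W 0<sumSub-W R ⟩
  (1ℚ + ½) * (W R /' sumSub W)
    ≡⟨ cong ((1ℚ + ½) *_) (πRC≡ R) ⟨
  (1ℚ + ½) * πRC ends (p + p) two R ∎
  where
  open ℚ.≤-Reasoning
  open Worm ends p (ℚ.<⇒≤ 0<p) p≤½
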